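{- Let $G_1$ and $G_2$ be two connected graphs with $V(G_1)\cap V(G_2)=\{v\}$, let $G=(V(G_1)\cup V(G_2),E(G_1)\cup E(G_2))$, and let $T\subseteq V(G)$ with $|T|$ even. For $i=1,2$ let $T_i$ be the one among $(T\cap V(G_i))\setminus\{v\}$ and $(T\cap V(G_i))\cup\{v\}$ that has even cardinality. Then $\mathrm{OPT}(G,T)=\mathrm{OPT}(G_1,T_1)+\mathrm{OPT}(G_2,T_2)$, $\mathrm{OPT}_{2EC}(G)=\mathrm{OPT}_{2EC}(G_1)+\mathrm{OPT}_{2EC}(G_2)$, and $\mathrm{LP}(G,T)=\mathrm{LP}(G_1,T_1)+\mathrm{LP}(G_2,T_2)$.
   Context: Graphs are finite, undirected, may have parallel edges, no loops; $2G$ is $G$ with each edge doubled, and a multi-subgraph of $G$ is a subgraph of $2G$. A $T$-join in $G$ ($|T|$ even) is $F\subseteq E(G)$ such that $T$ is exactly the set of vertices incident to an odd number of edges of $F$. A connected-$T$-join of $G$ is a $T$-join $F$ in $2G$ with $(V(G),F)$ connected; $\mathrm{OPT}(G,T)$ is the minimum cardinality of a connected-$T$-join of $G$. $\mathrm{OPT}_{2EC}(G)$ is the minimum number of edges of a 2-edge-connected spanning multi-subgraph of $G$. $\delta(X)$ is the set of edges with exactly one endpoint in $X$; $\delta(\mathcal{W})=\bigcup_{W\in\mathcal{W}}\delta(W)$ for a partition $\mathcal{W}$; $x(S)=\sum_{e\in S}x_e$. $\mathrm{LP}(G,T)=\min\{x(E(G)) : x\in\mathbb{R}^{E(G)}_{\ge0},\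 x(\delta(W))\ge2 \text{ for all } \emptyset\ne W\subsetneq V(G) \text{ with } |W\cap T| \text{ even},\ x(\delta(\mathcal{W}))\ge|\mathcal{W}|-1 \text{ for all partitions } \mathcal{W} \text{ of } V(G)\}$.
   Formalization: The vectors x in LP(G,T), LP(G₁,T₁) and LP(G₂,T₂) have rational entries instead of real ones. -}

module Defs where

open import Data.Bool using (Bool; true; false; if_then_else_; _xor_; _∨_)
open import Data.Nat as ℕ using (ℕ; zero; suc; _%_; _≡ᵇ_)
open import Data.Integer using (+_)
open import Data.Fin using (Fin; zero; suc; _↑ˡ_; _↑ʳ_; _≟_)
open import Data.Fin.Subset using (Subset; _∩_; ∣_∣)
open import Data.List using (List; []; _∷_; length; lookup; map; _++_; foldr; allFin)
open import Data.List.Relation.Unary.All using (All)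
open import Data.Vec using (Vec; _∷_; tabulate) renaming (lookup to vlookup)
open import Data.Product using (Σ; ∃; _×_; _,_)
open import Data.Sum using (_⊎_)
open import Data.Rational as ℚ using (ℚ; 0ℚ; 1ℚ)
open import Relation.Nullary using (¬_; Dec; yes; no)
open import Relation.Nullary.Decidable using (⌊_⌋)
open import Relation.Binary.PropositionalEquality using (_≡_; _≢_)

-- A graph on n vertices (V = Fin n) is given by its
-- list of edges (parallel edges allowed); loops are excluded by the
-- predicate Loopless.

Edges : ℕ → Set
Edges n = List (Fin n × Fin n)

Loopless : ∀ {n} → Edges n → Set
Loopless E = All (λ { (a , b) → a ≢ b }) E

EIdx : ∀ {n} → Edges n → Set
EIdx E = Fin (length E)

sumℕ : ∀ {k} → (Fin k → ℕ) → ℕ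
sumℕ {k} f = foldr ℕ._+_ 0 (map f (allFin k))

sumℚ : ∀ {k} → (Fin k → ℚ) → ℚ
sumℚ {k} f = foldr ℚ._+_ 0ℚ (map f (allFin k))

fromℕℚ : ℕ → ℚ
fromℕℚ k = (+ k) ℚ./ 1

incident : ∀ {n} → Fin n → Fin n × Fin n → Bool
incident u (a , b) = ⌊ u ≟ a ⌋ ∨ ⌊ u ≟ b ⌋

-- Multi-subgraphs of G: a subgraph of 2G is given by a multiplicity
-- m e ∈ {0,1,2} for each edge e of G.

MultiSub : ∀ {n} → Edges n → Set
MultiSub E = Σ (EIdx E → ℕ) (λ m → ∀ e → m e ℕ.≤ 2)

-- degree of u in the multigraph (V, F) (no loops, so each incident copy counts once)
deg : ∀ {n} (E : Edges n) → (EIdx E → ℕ) → Fin n → ℕ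
deg E m u = sumℕ (λ e → if incident u (lookup E e) then m e else 0)

size : ∀ {n} (E : Edges n) → (EIdx E → ℕ) → ℕ
size E m = sumℕ m

data Reach {n} (E : Edges n) (m : EIdx E → ℕ) : Fin n → Fin n → Set where
  here : ∀ {u} → Reach E m u u
  step : ∀ {u w z} (e : EIdx E) → 1 ℕ.≤ m e →
         (lookup E e ≡ (u , w) ⊎ lookup E e ≡ (w , u)) →
         Reach E m w z → Reach E m u z

ConnectedSub : ∀ {n} (E : Edges n) → (EIdx E → ℕ) → Set
ConnectedSub {n} E m = (u w : Fin n) → Reach E m u w

Connected : ∀ {n} → Edges n → Set
Connected E = ConnectedSub E (λ _ → 1)

IsTJoin : ∀ {n} (E : Edges n) → Subset n → (EIdx E → ℕ) → Set
IsTJoin {n} E T m = (u : Fin n) → deg E m u % 2 ≡ (if vlookup T u then 1 else 0)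

IsConnTJoin : ∀ {n} (E : Edges n) → Subset n → MultiSub E → Set
IsConnTJoin E T (m , _) = IsTJoin E T m × ConnectedSub E m

IsOPT : ∀ {n} (E : Edges n) → Subset n → ℕ → Set
IsOPT E T k =
  Σ (MultiSub E) (λ F → IsConnTJoin E T F × size E (Σ.proj₁ F) ≡ k)
  × (∀ F → IsConnTJoin E T F → k ℕ.≤ size E (Σ.proj₁ F))
  where open Data.Product

decrement : ∀ {k} → (Fin k → ℕ) → Fin k → (Fin k → ℕ)
decrement m e e' = if ⌊ e ≟ e' ⌋ then m e' ℕ.∸ 1 else m e'

Is2EC : ∀ {n} (E : Edges n) → MultiSub E → Set
Is2EC E (m , _) = ConnectedSub E m × (∀ e → 1 ℕ.≤ m e → ConnectedSub E (decrement m e))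

IsOPT2EC : ∀ {n} (E : Edges n) → ℕ → Set
IsOPT2EC E k =
  Σ (MultiSub E) (λ F → Is2EC E F × size E (proj₁ F) ≡ k)
  × (∀ F → Is2EC E F → k ℕ.≤ size E (proj₁ F))
  where open Data.Product

xCut : ∀ {n} (E : Edges n) → (EIdx E → ℚ) → Subset n → ℚ
xCut E x W = sumℚ (λ e → let (a , b) = lookup E e in
                         if vlookup W a xor vlookup W b then x e else 0ℚ)

xPart : ∀ {n k} (E : Edges n) → (EIdx E → ℚ) → (Fin n → Fin k) → ℚ
xPart E x p = sumℚ (λ e → let (a , b) = lookup E e in
                          if ⌊ p a ≟ p b ⌋ then 0ℚ else x e)

LPFeasible : ∀ {n} (E : Edges n) → Subset n → (EIdx E → ℚ) → Set
LPFeasible {n} E T x =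
  (∀ e → 0ℚ ℚ.≤ x e)
  × (∀ (W : Subset n) → (∃ λ u → vlookup W u ≡ true) → (∃ λ u → vlookup W u ≡ false)
       → ∣ W ∩ T ∣ % 2 ≡ 0 → fromℕℚ 2 ℚ.≤ xCut E x W)
  -- partitions 𝒲 of V into k nonempty classes, as surjections p : V → Fin k
  × (∀ (k : ℕ) (p : Fin n → Fin k) → (∀ j → ∃ λ u → p u ≡ j)
       → fromℕℚ k ℚ.- 1ℚ ℚ.≤ xPart E x p)

IsLP : ∀ {n} (E : Edges n) → Subset n → ℚ → Set
IsLP E T q =
  Σ (EIdx E → ℚ) (λ x → LPFeasible E T x × sumℚ x ≡ q)
  × (∀ x → LPFeasible E T x → q ℚ.≤ sumℚ x)

-- Gluing G₁ (on Fin (suc a)) and G₂ (on Fin (suc b)) at the vertex v,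
-- which is vertex zero in both.  G lives on Fin (suc (a + b)):
-- zero = v, then the a other vertices of G₁, then the b other vertices of G₂.

emb₁ : ∀ {a b} → Fin (suc a) → Fin (suc (a ℕ.+ b))
emb₁ zero = zero
emb₁ {a} {b} (suc i) = suc (i ↑ˡ b)

emb₂ : ∀ {a b} → Fin (suc b) → Fin (suc (a ℕ.+ b))
emb₂ zero = zero
emb₂ {a} {b} (suc j) = suc (a ↑ʳ j)

mapE : ∀ {n n'} → (Fin n → Fin n') → Edges n → Edges n'
mapE f = map (λ { (x , y) → (f x , f y) })

glue : ∀ {a b} → Edges (suc a) → Edges (suc b) → Edges (suc (a ℕ.+ b))
glue {a} {b} E₁ E₂ = mapE (emb₁ {a} {b}) E₁ ++ mapE (emb₂ {a} {b}) E₂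

evenChoice : ∀ {c} (N : ℕ) → (Fin (suc c) → Fin N) → Subset N → Subset (suc c)
evenChoice {c} N f T =
  if (∣ without ∣ % 2) ≡ᵇ 0 then without else with'
  where
  without with' : Subset (suc c)
  without = false ∷ tabulate (λ i → vlookup T (f (suc i)))
  with'   = true  ∷ tabulate (λ i → vlookup T (f (suc i)))

T₁ : ∀ {a b} → Subset (suc (a ℕ.+ b)) → Subset (suc a)
T₁ {a} {b} T = evenChoice (suc (a ℕ.+ b)) (emb₁ {a} {b}) T

T₂ : ∀ {a b} → Subset (suc (a ℕ.+ b)) → Subset (suc b)
T₂ {a} {b} T = evenChoice (suc (a ℕ.+ b)) (emb₂ {a} {b}) T

-- Cutting G at the shared vertex v splits every multi-subgraph, every cut δ(W) and every
-- partition of V(G) into the corresponding objects of G₁ and G₂, and conversely solutions for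
-- G₁ and G₂ glue to solutions for G with the sum of the costs; so each optimum is the sum of
-- the two optima once feasibility is shown to transfer in both directions. Parities are
-- what make this work: Tᵢ contains v exactly when T ∩ V(Gᵢ) ∖ {v} is odd, hence the parity of
-- |W ∩ T| is the sum of the parities of |Wᵢ ∩ Tᵢ| for the traces Wᵢ of W on V(Gᵢ). For the
-- LP, if both traces of an even cut W are odd then each is a proper cut of Gᵢ, and the
-- partition constraint for {Wᵢ, V(Gᵢ) ∖ Wᵢ} gives each of them weight at least 1; for a
-- partition of V(G) into k classes, every class is met on one side and the class of v on
-- both, so the numbers k₁, k₂ of classes met satisfy (k₁ - 1) + (k₂ - 1) ≥ k - 1.
module Submission where

open import Defs
open import Data.Nat using (ℕ; suc; _+_; _%_)
open import Data.Fin.Subset using (Subset; ∣_∣)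
open import Data.Rational using (ℚ) renaming (_+_ to _+ℚ_)
open import Data.Product using (_×_)
open import Relation.Binary.PropositionalEquality using (_≡_)

open import Level using (0ℓ)
open import Algebra.Bundles using (CommutativeMonoid)
import Algebra.Properties.CommutativeMonoid.Sum as Sum
import Algebra.Properties.CommutativeSemigroup as CommutativeSemigroupProperties
open import Data.Bool using (Bool; true; false; if_then_else_; _xor_; _∨_; _∧_)
import Data.Bool.Properties as BoolP
open import Data.Nat as ℕ using (zero; _≤_; z≤n; s≤s; _∸_; parity)
import Data.Nat.Properties as ℕP
open import Data.Nat.DivMod using ([m+n]%n≡m%n)
import Data.Nat.Coprimality as Coprimality
open import Data.Parity using (Parity; 0ℙ; 1ℙ) renaming (_+_ to _+ℙ_; _*_ to _*ℙ_)
import Data.Parity.Properties as ℙP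
import Data.Integer as ℤ
import Data.Integer.Properties as ℤP
import Data.Rational as ℚ
import Data.Rational.Properties as ℚP
open import Data.Rational.Solver using (module +-*-Solver)
open import Data.Fin as Fin using (Fin; zero; suc; _↑ˡ_; _↑ʳ_; punchIn; punchOut; splitAt)
import Data.Fin.Properties as FinP
open import Data.Fin.Subset using (_∩_)
open import Data.List as List using (List; []; _∷_; length; lookup; allFin)
open import Data.List.Relation.Unary.All as All using (All)
import Data.List.Relation.Unary.All.Properties as AllP
open import Data.List.Membership.Propositional.Properties using (∈-lookup)
open import Data.Vec as Vec using (tabulate) renaming (lookup to vlookup)
import Data.Vec.Properties as VecP
open import Data.Vec.Functional using (Vector)
open import Data.Product using (Σ; ∃; _,_; proj₁; proj₂)
open import Data.Sum using (_⊎_; inj₁; inj₂)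
open import Function using (_∘_; _⇔_; mk⇔)
open import Relation.Nullary using (¬_; Dec; yes; no; contradiction)
open import Relation.Nullary.Decidable using (⌊_⌋; isYes≗does; dec-true; dec-false; does-⇔)
open import Relation.Binary.PropositionalEquality
  using (_≢_; _≗_; refl; sym; trans; cong; cong₂; subst; subst₂; module ≡-Reasoning)

⌊⌋-true : ∀ {A : Set} (a? : Dec A) → A → ⌊ a? ⌋ ≡ true
⌊⌋-true a? a = trans (isYes≗does a?) (dec-true a? a)

⌊⌋-false : ∀ {A : Set} (a? : Dec A) → ¬ A → ⌊ a? ⌋ ≡ false
⌊⌋-false a? ¬a = trans (isYes≗does a?) (dec-false a? ¬a)

⌊⌋-⇔ : ∀ {A B : Set} → A ⇔ B → (a? : Dec A) (b? : Dec B) → ⌊ a? ⌋ ≡ ⌊ b? ⌋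
⌊⌋-⇔ A⇔B a? b? = trans (isYes≗does a?) (trans (does-⇔ A⇔B a? b?) (sym (isYes≗does b?)))

module SumProperties (M : CommutativeMonoid 0ℓ 0ℓ) where
  open CommutativeMonoid M
    using (Carrier; _≈_; _∙_; ε; setoid; identityˡ; assoc; ∙-congˡ)
    renaming (sym to ≈-sym; trans to ≈-trans)
  open Sum M public
  open import Relation.Binary.Reasoning.Setoid setoid

  foldr-map-tabulate : ∀ {B : Set} {k} (f : B → Carrier) (g : Fin k → B) →
    List.foldr _∙_ ε (List.map f (List.tabulate g)) ≡ sum (f ∘ g)
  foldr-map-tabulate {k = zero}  f g = refl
  foldr-map-tabulate {k = suc k} f g = cong (f (g zero) ∙_) (foldr-map-tabulate f (g ∘ suc))

  foldr-allFin : ∀ {k} (f : Fin k → Carrier) → List.foldr _∙_ ε (List.map f (allFin k)) ≡ sum f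
  foldr-allFin f = foldr-map-tabulate f (λ i → i)

  sum-zero : ∀ {k} (f : Vector Carrier k) → (∀ i → f i ≈ ε) → sum f ≈ ε
  sum-zero {k} f f≈ε = ≈-trans (sum-cong-≋ f≈ε) (sum-replicate-zero k)

  sum-↑ : ∀ a b (f : Vector Carrier (a ℕ.+ b)) →
    sum f ≈ sum (f ∘ (_↑ˡ b)) ∙ sum (f ∘ (a ↑ʳ_))
  sum-↑ zero    b f = ≈-sym (identityˡ _)
  sum-↑ (suc a) b f = begin
    f zero ∙ sum (f ∘ suc)                                       ≈⟨ ∙-congˡ (sum-↑ a b (f ∘ suc)) ⟩
    f zero ∙ (sum (f ∘ suc ∘ (_↑ˡ b)) ∙ sum (f ∘ suc ∘ (a ↑ʳ_))) ≈⟨ ≈-sym (assoc _ _ _) ⟩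
    (f zero ∙ sum (f ∘ suc ∘ (_↑ˡ b))) ∙ sum (f ∘ suc ∘ (a ↑ʳ_)) ∎

module Σℕ = SumProperties ℕP.+-0-commutativeMonoid
module Σℚ = SumProperties ℚP.+-0-commutativeMonoid
module Σℙ = SumProperties ℙP.+-0-commutativeMonoid

∑ℕ : ∀ {k} → (Fin k → ℕ) → ℕ
∑ℕ = Σℕ.sum

∑ℚ : ∀ {k} → (Fin k → ℚ) → ℚ
∑ℚ = Σℚ.sum

∑ℙ : ∀ {k} → (Fin k → Parity) → Parity
∑ℙ = Σℙ.sum

sumℕ≡∑ℕ : ∀ {k} (f : Fin k → ℕ) → sumℕ f ≡ ∑ℕ f
sumℕ≡∑ℕ = Σℕ.foldr-allFin

sumℚ≡∑ℚ : ∀ {k} (f : Fin k → ℚ) → sumℚ f ≡ ∑ℚ f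
sumℚ≡∑ℚ = Σℚ.foldr-allFin

sumℚ-cong : ∀ {k} {f g : Fin k → ℚ} → f ≗ g → sumℚ f ≡ sumℚ g
sumℚ-cong {f = f} {g} f≗g = trans (sumℚ≡∑ℚ f) (trans (Σℚ.sum-cong-≗ f≗g) (sym (sumℚ≡∑ℚ g)))

∑ℕ-mono-≤ : ∀ {k} {f g : Fin k → ℕ} → (∀ i → f i ≤ g i) → ∑ℕ f ≤ ∑ℕ g
∑ℕ-mono-≤ {zero}  f≤g = z≤n
∑ℕ-mono-≤ {suc k} f≤g = ℕP.+-mono-≤ (f≤g zero) (∑ℕ-mono-≤ (f≤g ∘ suc))

∑ℕ-const-1 : ∀ k → ∑ℕ {k} (λ _ → 1) ≡ k
∑ℕ-const-1 zero    = refl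
∑ℕ-const-1 (suc k) = cong suc (∑ℕ-const-1 k)

∑ℕ-indicator : ∀ {k} (a : Fin k) (c : ℕ) → ∑ℕ (λ u → if ⌊ u Fin.≟ a ⌋ then c else 0) ≡ c
∑ℕ-indicator {suc k} a c = begin
  ∑ℕ (λ u → if ⌊ u Fin.≟ a ⌋ then c else 0)
    ≡⟨ Σℕ.sum-remove {i = a} (λ u → if ⌊ u Fin.≟ a ⌋ then c else 0) ⟩
  (if ⌊ a Fin.≟ a ⌋ then c else 0) + ∑ℕ (λ u → if ⌊ punchIn a u Fin.≟ a ⌋ then c else 0)
    ≡⟨ cong₂ _+_ (cong (if_then c else 0) (⌊⌋-true (a Fin.≟ a) refl))
                 (Σℕ.sum-zero (λ u → if ⌊ punchIn a u Fin.≟ a ⌋ then c else 0) elsewhere) ⟩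
  c + 0
    ≡⟨ ℕP.+-identityʳ c ⟩
  c ∎
  where
  open ≡-Reasoning
  elsewhere : ∀ u → (if ⌊ punchIn a u Fin.≟ a ⌋ then c else 0) ≡ 0
  elsewhere u = cong (if_then c else 0) (⌊⌋-false (punchIn a u Fin.≟ a) (FinP.punchInᵢ≢i a u))

ℙ[_] : Bool → Parity
ℙ[ b ] = if b then 1ℙ else 0ℙ

bit : Parity → ℕ
bit 0ℙ = 0
bit 1ℙ = 1

bit-injective : ∀ {p q} → bit p ≡ bit q → p ≡ q
bit-injective {0ℙ} {0ℙ} _ = refl
bit-injective {1ℙ} {1ℙ} _ = refl

bit-ℙ[] : ∀ b → bit ℙ[ b ] ≡ (if b then 1 else 0)
bit-ℙ[] true  = refl
bit-ℙ[] false = refl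

%2≡bit∘parity : ∀ n → n % 2 ≡ bit (parity n)
%2≡bit∘parity zero          = refl
%2≡bit∘parity (suc zero)    = refl
%2≡bit∘parity (suc (suc n)) = begin
  (2 + n) % 2    ≡⟨ cong (_% 2) (ℕP.+-comm 2 n) ⟩
  (n + 2) % 2    ≡⟨ [m+n]%n≡m%n n 2 ⟩
  n % 2          ≡⟨ %2≡bit∘parity n ⟩
  bit (parity n) ∎
  where open ≡-Reasoning

%2≡⇒parity≡ : ∀ n b → n % 2 ≡ (if b then 1 else 0) → parity n ≡ ℙ[ b ]
%2≡⇒parity≡ n b eq = bit-injective (trans (sym (%2≡bit∘parity n)) (trans eq (sym (bit-ℙ[] b))))

parity≡⇒%2≡ : ∀ n b → parity n ≡ ℙ[ b ] → n % 2 ≡ (if b then 1 else 0)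
parity≡⇒%2≡ n b eq = trans (%2≡bit∘parity n) (trans (cong bit eq) (bit-ℙ[] b))

even⇒parity≡0ℙ : ∀ n → n % 2 ≡ 0 → parity n ≡ 0ℙ
even⇒parity≡0ℙ n = %2≡⇒parity≡ n false

parity≡0ℙ⇒even : ∀ n → parity n ≡ 0ℙ → n % 2 ≡ 0
parity≡0ℙ⇒even n = parity≡⇒%2≡ n false

+ℙ≡0ℙ⇒≡ : ∀ {p q} → p +ℙ q ≡ 0ℙ → p ≡ q
+ℙ≡0ℙ⇒≡ {p} {q} p+q≡0 = ℙP.+-cancelʳ-≡ q p q (trans p+q≡0 (sym (ℙP.p+p≡0ℙ q)))

parity-∑ : ∀ {k} (f : Fin k → ℕ) → parity (∑ℕ f) ≡ ∑ℙ (parity ∘ f)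
parity-∑ {zero}  f = refl
parity-∑ {suc k} f =
  trans (ℙP.+-homo-+ (f zero) _) (cong (parity (f zero) +ℙ_) (parity-∑ (f ∘ suc)))

parity-∣∣ : ∀ {k} (W : Subset k) → parity ∣ W ∣ ≡ ∑ℙ (λ u → ℙ[ vlookup W u ])
parity-∣∣ Vec.[]          = refl
parity-∣∣ (true  Vec.∷ W) = trans (ℙP.+-homo-+ 1 ∣ W ∣) (cong (1ℙ +ℙ_) (parity-∣∣ W))
parity-∣∣ (false Vec.∷ W) = parity-∣∣ W

ℙ[∧] : ∀ a b → ℙ[ a ∧ b ] ≡ ℙ[ a ] *ℙ ℙ[ b ]
ℙ[∧] true  b = sym (ℙP.*-identityˡ ℙ[ b ])
ℙ[∧] false b = refl

parity-∣∩∣ : ∀ {k} (W T : Subset k) →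
  parity ∣ W ∩ T ∣ ≡ ∑ℙ (λ u → ℙ[ vlookup W u ] *ℙ ℙ[ vlookup T u ])
parity-∣∩∣ W T = trans (parity-∣∣ (W ∩ T)) (Σℙ.sum-cong-≗ λ u →
  trans (cong ℙ[_] (VecP.lookup-zipWith _∧_ u W T)) (ℙ[∧] (vlookup W u) (vlookup T u)))

parity-∣∩∣-cong : ∀ {k} (W W′ T : Subset k) → (∀ u → vlookup W u ≡ vlookup W′ u) →
  parity ∣ W ∩ T ∣ ≡ parity ∣ W′ ∩ T ∣
parity-∣∩∣-cong W W′ T W≗W′ = trans (parity-∣∩∣ W T) (trans
  (Σℙ.sum-cong-≗ (λ u → cong (λ w → ℙ[ w ] *ℙ ℙ[ vlookup T u ]) (W≗W′ u)))
  (sym (parity-∣∩∣ W′ T)))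

parity-∣∩∣-const : ∀ {k} (W T : Subset k) {b} → (∀ u → vlookup W u ≡ b) → ∣ T ∣ % 2 ≡ 0 →
  parity ∣ W ∩ T ∣ ≡ 0ℙ
parity-∣∩∣-const W T {true} W≡true T-even = begin
  parity ∣ W ∩ T ∣
    ≡⟨ parity-∣∩∣ W T ⟩
  ∑ℙ (λ u → ℙ[ vlookup W u ] *ℙ ℙ[ vlookup T u ])
    ≡⟨ Σℙ.sum-cong-≗ (λ u → cong (λ w → ℙ[ w ] *ℙ ℙ[ vlookup T u ]) (W≡true u)) ⟩
  ∑ℙ (λ u → ℙ[ vlookup T u ])
    ≡⟨ sym (parity-∣∣ T) ⟩
  parity ∣ T ∣
    ≡⟨ even⇒parity≡0ℙ ∣ T ∣ T-even ⟩
  0ℙ ∎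
  where open ≡-Reasoning
parity-∣∩∣-const W T {false} W≡false _ = trans (parity-∣∩∣ W T)
  (Σℙ.sum-zero _ (λ u → cong (λ w → ℙ[ w ] *ℙ ℙ[ vlookup T u ]) (W≡false u)))

root-parity : ∀ {c} (S : Subset (suc c)) → ∣ S ∣ % 2 ≡ 0 →
  ℙ[ vlookup S zero ] ≡ ∑ℙ (λ x → ℙ[ vlookup S (suc x) ])
root-parity S S-even = +ℙ≡0ℙ⇒≡ (trans (sym (parity-∣∣ S)) (even⇒parity≡0ℙ ∣ S ∣ S-even))

-- Minima of additively separable problems

IsMinimum : {A C : Set} → (C → C → Set) → (A → Set) → (A → C) → C → Set
IsMinimum {A} _≼_ P f c = Σ A (λ x → P x × f x ≡ c) × (∀ x → P x → c ≼ f x)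

minimum-+ : {A A₁ A₂ C : Set} {_≼_ : C → C → Set} {_⊕_ : C → C → C} →
  (∀ {a b c d} → a ≼ b → c ≼ d → (a ⊕ c) ≼ (b ⊕ d)) →
  {P : A → Set} {P₁ : A₁ → Set} {P₂ : A₂ → Set} →
  {f : A → C} {f₁ : A₁ → C} {f₂ : A₂ → C} →
  (∀ x₁ x₂ → P₁ x₁ → P₂ x₂ → Σ A λ x → P x × f x ≡ f₁ x₁ ⊕ f₂ x₂) →
  (∀ x → P x → Σ A₁ λ x₁ → Σ A₂ λ x₂ → P₁ x₁ × P₂ x₂ × f x ≡ f₁ x₁ ⊕ f₂ x₂) →
  ∀ {c₁ c₂} → IsMinimum _≼_ P₁ f₁ c₁ → IsMinimum _≼_ P₂ f₂ c₂ → IsMinimum _≼_ P f (c₁ ⊕ c₂)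
minimum-+ {_≼_ = _≼_} {_⊕_} mono glue split
          ((x₁ , P₁x₁ , f₁x₁≡c₁) , min₁) ((x₂ , P₂x₂ , f₂x₂≡c₂) , min₂) =
  (let (x , Px , fx≡) = glue x₁ x₂ P₁x₁ P₂x₂ in x , Px , trans fx≡ (cong₂ _⊕_ f₁x₁≡c₁ f₂x₂≡c₂)) ,
  λ x Px → let (y₁ , y₂ , P₁y₁ , P₂y₂ , fx≡) = split x Px in
    subst (_ ≼_) (sym fx≡) (mono (min₁ y₁ P₁y₁) (min₂ y₂ P₂y₂))

-- Multigraphs and T-joins

both : ∀ {m n} → (Fin m → Fin n) → Fin m × Fin m → Fin n × Fin n
both f (a , b) = f a , f b

decrement-cong : ∀ {k} {m m′ : Fin k → ℕ} → m ≗ m′ → ∀ e → decrement m e ≗ decrement m′ e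
decrement-cong m≗m′ e e′ =
  cong₂ (λ y z → if ⌊ e Fin.≟ e′ ⌋ then y else z) (cong (_∸ 1) (m≗m′ e′)) (m≗m′ e′)

module _ {n} {E : Edges n} where

  reach-++ : ∀ {m u w z} → Reach E m u w → Reach E m w z → Reach E m u z
  reach-++ here              r′ = r′
  reach-++ (step e m≥1 e∈ r) r′ = step e m≥1 e∈ (reach-++ r r′)

  reach-cong : ∀ {m m′} → m ≗ m′ → ∀ {u w} → Reach E m u w → Reach E m′ u w
  reach-cong m≗m′ here              = here
  reach-cong m≗m′ (step e m≥1 e∈ r) =
    step e (subst (1 ≤_) (m≗m′ e) m≥1) e∈ (reach-cong m≗m′ r)

  connected-cong : ∀ {m m′} → m ≗ m′ → ConnectedSub E m → ConnectedSub E m′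
  connected-cong m≗m′ C u w = reach-cong m≗m′ (C u w)

degTerm : ∀ {n} → Fin n → Fin n × Fin n → ℕ → ℕ
degTerm u ab y = if incident u ab then y else 0

module _ {n} (E : Edges n) where

  deg-∑ : ∀ m u → deg E m u ≡ ∑ℕ (λ e → degTerm u (lookup E e) (m e))
  deg-∑ m u = sumℕ≡∑ℕ (λ e → degTerm u (lookup E e) (m e))

  size-∑ : ∀ m → size E m ≡ ∑ℕ m
  size-∑ m = sumℕ≡∑ℕ m

  deg-cong : ∀ {m m′} → m ≗ m′ → ∀ u → deg E m u ≡ deg E m′ u
  deg-cong {m} {m′} m≗m′ u = trans (deg-∑ m u)
    (trans (Σℕ.sum-cong-≗ (λ e → cong (degTerm u (lookup E e)) (m≗m′ e))) (sym (deg-∑ m′ u)))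

  size-cong : ∀ {m m′} → m ≗ m′ → size E m ≡ size E m′
  size-cong {m} {m′} m≗m′ = trans (size-∑ m) (trans (Σℕ.sum-cong-≗ m≗m′) (sym (size-∑ m′)))

∑ℕ-degTerm : ∀ {n} (a b : Fin n) (c : ℕ) → a ≢ b → ∑ℕ (λ u → degTerm u (a , b) c) ≡ c + c
∑ℕ-degTerm {n} a b c a≢b = begin
  ∑ℕ (λ u → degTerm u (a , b) c)
    ≡⟨ Σℕ.sum-cong-≗ (λ u → split-∨ (u Fin.≟ a) (u Fin.≟ b)) ⟩
  ∑ℕ (λ u → at a u + at b u)
    ≡⟨ Σℕ.∑-distrib-+ (at a) (at b) ⟩
  ∑ℕ (at a) + ∑ℕ (at b)
    ≡⟨ cong₂ _+_ (∑ℕ-indicator a c) (∑ℕ-indicator b c) ⟩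
  c + c ∎
  where
  open ≡-Reasoning
  at : Fin n → Fin n → ℕ
  at v u = if ⌊ u Fin.≟ v ⌋ then c else 0
  split-∨ : ∀ {u} (u≟a : Dec (u ≡ a)) (u≟b : Dec (u ≡ b)) →
    (if ⌊ u≟a ⌋ ∨ ⌊ u≟b ⌋ then c else 0) ≡ (if ⌊ u≟a ⌋ then c else 0) + (if ⌊ u≟b ⌋ then c else 0)
  split-∨ (yes refl) (yes refl) = contradiction refl a≢b
  split-∨ (yes _)    (no _)     = sym (ℕP.+-identityʳ c)
  split-∨ (no _)     _          = refl

handshake : ∀ {n} {E : Edges n} → Loopless E → ∀ m → ∑ℕ (deg E m) ≡ size E m + size E m
handshake {E = E} loopless m = begin
  ∑ℕ (deg E m)                                         ≡⟨ Σℕ.sum-cong-≗ (deg-∑ E m) ⟩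
  ∑ℕ (λ u → ∑ℕ (λ e → degTerm u (lookup E e) (m e)))  ≡⟨ Σℕ.∑-comm (λ u e → degTerm u (lookup E e) (m e)) ⟩
  ∑ℕ (λ e → ∑ℕ (λ u → degTerm u (lookup E e) (m e)))  ≡⟨ Σℕ.sum-cong-≗ edge-counted-twice ⟩
  ∑ℕ (λ e → m e + m e)                                 ≡⟨ Σℕ.∑-distrib-+ m m ⟩
  ∑ℕ m + ∑ℕ m                                          ≡⟨ sym (cong₂ _+_ (size-∑ E m) (size-∑ E m)) ⟩
  size E m + size E m                                  ∎
  where
  open ≡-Reasoning
  edge-counted-twice : ∀ e → ∑ℕ (λ u → degTerm u (lookup E e) (m e)) ≡ m e + m e
  edge-counted-twice e = ∑ℕ-degTerm _ _ (m e) (All.lookup loopless (∈-lookup e))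

IsTJoin⇒parity : ∀ {n} {E : Edges n} {T m} → IsTJoin E T m →
  ∀ u → parity (deg E m u) ≡ ℙ[ vlookup T u ]
IsTJoin⇒parity {E = E} {T} {m} J u = %2≡⇒parity≡ (deg E m u) (vlookup T u) (J u)

-- Both the degree sum and ∣ T ∣ are even, so the condition at vertex zero follows from the rest.
IsTJoin-fromSuc : ∀ {n} {E : Edges (suc n)} {T m} → Loopless E → ∣ T ∣ % 2 ≡ 0 →
  (∀ x → parity (deg E m (suc x)) ≡ ℙ[ vlookup T (suc x) ]) → IsTJoin E T m
IsTJoin-fromSuc {E = E} {T} {m} loopless T-even deg-suc u =
  parity≡⇒%2≡ (deg E m u) (vlookup T u) (at u)
  where
  rest : Parity
  rest = ∑ℙ (λ x → ℙ[ vlookup T (suc x) ])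

  deg-total : parity (deg E m zero) +ℙ rest ≡ 0ℙ
  deg-total = begin
    parity (deg E m zero) +ℙ rest
      ≡⟨ cong (parity (deg E m zero) +ℙ_) (Σℙ.sum-cong-≗ (sym ∘ deg-suc)) ⟩
    ∑ℙ (parity ∘ deg E m)                   ≡⟨ sym (parity-∑ (deg E m)) ⟩
    parity (∑ℕ (deg E m))                   ≡⟨ cong parity (handshake loopless m) ⟩
    parity (size E m + size E m)            ≡⟨ ℙP.+-homo-+ (size E m) (size E m) ⟩
    parity (size E m) +ℙ parity (size E m)  ≡⟨ ℙP.p+p≡0ℙ (parity (size E m)) ⟩
    0ℙ                                      ∎
    where open ≡-Reasoning

  T-total : ℙ[ vlookup T zero ] +ℙ rest ≡ 0ℙ
  T-total = trans (sym (parity-∣∣ T)) (even⇒parity≡0ℙ ∣ T ∣ T-even)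

  at : ∀ u → parity (deg E m u) ≡ ℙ[ vlookup T u ]
  at zero    = ℙP.+-cancelʳ-≡ rest _ _ (trans deg-total (sym T-total))
  at (suc x) = deg-suc x

-- The LP

fromℕℚ≡mkℚ : ∀ k → fromℕℚ k ≡ ℚ.mkℚ (ℤ.+ k) 0 (Coprimality.sym (Coprimality.1-coprimeTo k))
fromℕℚ≡mkℚ k = ℚP.normalize-coprime (Coprimality.sym (Coprimality.1-coprimeTo k))

fromℕℚ-+ : ∀ m k → fromℕℚ (m + k) ≡ fromℕℚ m ℚ.+ fromℕℚ k
fromℕℚ-+ m k rewrite fromℕℚ≡mkℚ m | fromℕℚ≡mkℚ k =
  cong₂ (λ i j → (i ℤ.+ j) ℚ./ 1) (sym (ℤP.*-identityʳ (ℤ.+ m))) (sym (ℤP.*-identityʳ (ℤ.+ k)))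

fromℕℚ-mono-≤ : ∀ {m k} → m ≤ k → fromℕℚ m ℚ.≤ fromℕℚ k
fromℕℚ-mono-≤ {m} {k} m≤k rewrite fromℕℚ≡mkℚ m | fromℕℚ≡mkℚ k =
  ℚ.*≤* (subst₂ ℤ._≤_ (sym (ℤP.*-identityʳ (ℤ.+ m))) (sym (ℤP.*-identityʳ (ℤ.+ k))) (ℤ.+≤+ m≤k))

fromℕℚ-minus-one-≤ : ∀ {k h₁ h₂} → k + 1 ≤ h₁ + h₂ →
  fromℕℚ k ℚ.- ℚ.1ℚ ℚ.≤ (fromℕℚ h₁ ℚ.- ℚ.1ℚ) ℚ.+ (fromℕℚ h₂ ℚ.- ℚ.1ℚ)
fromℕℚ-minus-one-≤ {k} {h₁} {h₂} k+1≤h₁+h₂ = begin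
  fromℕℚ k - 1ℚ
    ≡⟨ solve 1 (λ q → q :- con 1ℚ := ((q :+ con 1ℚ) :- con 1ℚ) :- con 1ℚ) refl (fromℕℚ k) ⟩
  ((fromℕℚ k ℚ.+ 1ℚ) - 1ℚ) - 1ℚ
    ≡⟨ cong (λ q → (q - 1ℚ) - 1ℚ) (sym (fromℕℚ-+ k 1)) ⟩
  (fromℕℚ (k + 1) - 1ℚ) - 1ℚ
    ≤⟨ ℚP.+-monoˡ-≤ (ℚ.- 1ℚ) (ℚP.+-monoˡ-≤ (ℚ.- 1ℚ) (fromℕℚ-mono-≤ k+1≤h₁+h₂)) ⟩
  (fromℕℚ (h₁ + h₂) - 1ℚ) - 1ℚ
    ≡⟨ cong (λ q → (q - 1ℚ) - 1ℚ) (fromℕℚ-+ h₁ h₂) ⟩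
  ((fromℕℚ h₁ ℚ.+ fromℕℚ h₂) - 1ℚ) - 1ℚ
    ≡⟨ solve 2 (λ p q → ((p :+ q) :- con 1ℚ) :- con 1ℚ := (p :- con 1ℚ) :+ (q :- con 1ℚ))
             refl (fromℕℚ h₁) (fromℕℚ h₂) ⟩
  (fromℕℚ h₁ - 1ℚ) ℚ.+ (fromℕℚ h₂ - 1ℚ) ∎
  where
  open ℚP.≤-Reasoning
  open +-*-Solver
  open Data.Rational using (_-_; 1ℚ)

∑ℚ-nonneg : ∀ {k} (f : Fin k → ℚ) → (∀ i → ℚ.0ℚ ℚ.≤ f i) → ℚ.0ℚ ℚ.≤ ∑ℚ f
∑ℚ-nonneg {zero}  f f≥0 = ℚP.≤-refl
∑ℚ-nonneg {suc k} f f≥0 = ℚP.+-mono-≤ (f≥0 zero) (∑ℚ-nonneg (f ∘ suc) (f≥0 ∘ suc))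

cutTerm : ∀ {n} → Subset n → Fin n × Fin n → ℚ → ℚ
cutTerm W (a , b) y = if vlookup W a xor vlookup W b then y else ℚ.0ℚ

partTerm : ∀ {n k} → (Fin n → Fin k) → Fin n × Fin n → ℚ → ℚ
partTerm p (a , b) y = if ⌊ p a Fin.≟ p b ⌋ then ℚ.0ℚ else y

module _ {n} (E : Edges n) where

  xCut-∑ : ∀ x W → xCut E x W ≡ ∑ℚ (λ e → cutTerm W (lookup E e) (x e))
  xCut-∑ x W = sumℚ≡∑ℚ (λ e → cutTerm W (lookup E e) (x e))

  xPart-∑ : ∀ {k} x (p : Fin n → Fin k) → xPart E x p ≡ ∑ℚ (λ e → partTerm p (lookup E e) (x e))
  xPart-∑ x p = sumℚ≡∑ℚ (λ e → partTerm p (lookup E e) (x e))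

  xCut-cong : ∀ {x x′} → x ≗ x′ → ∀ W → xCut E x W ≡ xCut E x′ W
  xCut-cong {x} {x′} x≗x′ W = trans (xCut-∑ x W)
    (trans (Σℚ.sum-cong-≗ (λ e → cong (cutTerm W (lookup E e)) (x≗x′ e))) (sym (xCut-∑ x′ W)))

  xPart-cong : ∀ {x x′} → x ≗ x′ → ∀ {k} (p : Fin n → Fin k) → xPart E x p ≡ xPart E x′ p
  xPart-cong {x} {x′} x≗x′ p = trans (xPart-∑ x p)
    (trans (Σℚ.sum-cong-≗ (λ e → cong (partTerm p (lookup E e)) (x≗x′ e))) (sym (xPart-∑ x′ p)))

Proper : ∀ {n} → Subset n → Set
Proper W = (∃ λ u → vlookup W u ≡ true) × (∃ λ u → vlookup W u ≡ false)

constant-or-proper : ∀ {k} (S : Subset (suc k)) → (∀ u → vlookup S u ≡ vlookup S zero) ⊎ Proper S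
constant-or-proper {k} S with FinP.all? (λ u → vlookup S u BoolP.≟ vlookup S zero)
... | yes constant = inj₁ constant
... | no ¬constant =
  inj₂ (proper (FinP.¬∀⟶∃¬ (suc k) _ (λ u → vlookup S u BoolP.≟ vlookup S zero) ¬constant))
  where
  proper : (∃ λ u → vlookup S u ≢ vlookup S zero) → Proper S
  proper (u , S-u≢S-0) with vlookup S u in eq-u | vlookup S zero in eq-0
  ... | true  | true  = contradiction refl S-u≢S-0
  ... | true  | false = (u , eq-u) , (zero , eq-0)
  ... | false | true  = (zero , eq-0) , (u , eq-u)
  ... | false | false = contradiction refl S-u≢S-0

inImage : ∀ {m k} → (Fin m → Fin k) → Fin k → Bool
inImage p j = ⌊ FinP.any? (λ u → p u Fin.≟ j) ⌋

inImage-true : ∀ {m k} (p : Fin m → Fin k) {j} u → p u ≡ j → inImage p j ≡ true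
inImage-true p {j} u pu≡j = ⌊⌋-true (FinP.any? (λ u → p u Fin.≟ j)) (u , pu≡j)

imageSize : ∀ {m k} → (Fin m → Fin k) → ℕ
imageSize p = ∑ℕ (λ j → if inImage p j then 1 else 0)

module DropUnusedLabel {m k} (p : Fin m → Fin (suc k)) (j : Fin (suc k)) (unused : ∀ u → j ≢ p u) where

  relabel : Fin m → Fin k
  relabel u = punchOut (unused u)

  same-class : ∀ u v → ⌊ relabel u Fin.≟ relabel v ⌋ ≡ ⌊ p u Fin.≟ p v ⌋
  same-class u v = ⌊⌋-⇔ (mk⇔ (FinP.punchOut-injective (unused u) (unused v)) (FinP.punchOut-cong j))
    (relabel u Fin.≟ relabel v) (p u Fin.≟ p v)

  inImage-relabel : ∀ c → inImage p (punchIn j c) ≡ inImage relabel c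
  inImage-relabel c =
    ⌊⌋-⇔ (mk⇔ to from) (FinP.any? (λ u → p u Fin.≟ punchIn j c)) (FinP.any? (λ u → relabel u Fin.≟ c))
    where
    to : (∃ λ u → p u ≡ punchIn j c) → ∃ λ u → relabel u ≡ c
    to (u , pu≡) = u , trans (FinP.punchOut-cong j pu≡) (FinP.punchOut-punchIn j)
    from : (∃ λ u → relabel u ≡ c) → ∃ λ u → p u ≡ punchIn j c
    from (u , pu≡) = u , trans (sym (FinP.punchIn-punchOut (unused u))) (cong (punchIn j) pu≡)

  imageSize-relabel : imageSize p ≡ imageSize relabel
  imageSize-relabel = begin
    imageSize p
      ≡⟨ Σℕ.sum-remove {i = j} (λ c → if inImage p c then 1 else 0) ⟩
    (if inImage p j then 1 else 0) + ∑ℕ (λ c → if inImage p (punchIn j c) then 1 else 0)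
      ≡⟨ cong₂ _+_ (cong (if_then 1 else 0) j-unused)
                   (Σℕ.sum-cong-≗ (cong (if_then 1 else 0) ∘ inImage-relabel)) ⟩
    imageSize relabel ∎
    where
    open ≡-Reasoning
    j-unused : inImage p j ≡ false
    j-unused = ⌊⌋-false (FinP.any? (λ u → p u Fin.≟ j)) λ (u , pu≡j) → unused u (sym pu≡j)

module _ {n} (E : Edges (suc n)) (T : Subset (suc n)) {x} (feasible : LPFeasible E T x) where
  private
    x≥0 : ∀ e → ℚ.0ℚ ℚ.≤ x e
    x≥0 = proj₁ feasible

    partition-constraint : ∀ k (p : Fin (suc n) → Fin k) → (∀ j → ∃ λ u → p u ≡ j) →
      fromℕℚ k ℚ.- ℚ.1ℚ ℚ.≤ xPart E x p
    partition-constraint = proj₂ (proj₂ feasible)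

  xCut-nonneg : ∀ W → ℚ.0ℚ ℚ.≤ xCut E x W
  xCut-nonneg W = subst (ℚ.0ℚ ℚ.≤_) (sym (xCut-∑ E x W)) (∑ℚ-nonneg _ λ e → term≥0 (lookup E e) (x≥0 e))
    where
    term≥0 : ∀ ab {y} → ℚ.0ℚ ℚ.≤ y → ℚ.0ℚ ℚ.≤ cutTerm W ab y
    term≥0 (a , b) y≥0 with vlookup W a xor vlookup W b
    ... | true  = y≥0
    ... | false = ℚP.≤-refl

  -- The partition constraint for {W, V ∖ W}.
  xCut-≥1 : ∀ W → Proper W → ℚ.1ℚ ℚ.≤ xCut E x W
  xCut-≥1 W ((u , u∈W) , (u′ , u′∉W)) = subst (ℚ.1ℚ ℚ.≤_) xPart≡xCut (partition-constraint 2 side onto)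
    where
    side : Fin (suc n) → Fin 2
    side u = if vlookup W u then suc zero else zero

    onto : ∀ i → ∃ λ u → side u ≡ i
    onto zero       = u′ , cong (if_then suc zero else zero) u′∉W
    onto (suc zero) = u , cong (if_then suc zero else zero) u∈W

    terms : ∀ ab y → partTerm side ab y ≡ cutTerm W ab y
    terms (a , b) y with vlookup W a | vlookup W b
    ... | true  | true  = refl
    ... | true  | false = refl
    ... | false | true  = refl
    ... | false | false = refl

    xPart≡xCut : xPart E x side ≡ xCut E x W
    xPart≡xCut = trans (xPart-∑ E x side)
      (trans (Σℚ.sum-cong-≗ (λ e → terms (lookup E e) (x e))) (sym (xCut-∑ E x W)))

  partition-constraint-on-image : ∀ {k} (p : Fin (suc n) → Fin k) →
    fromℕℚ (imageSize p) ℚ.- ℚ.1ℚ ℚ.≤ xPart E x p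
  partition-constraint-on-image {zero}  p = contradiction (p zero) λ ()
  partition-constraint-on-image {suc k} p with FinP.all? (λ j → FinP.any? (λ u → p u Fin.≟ j))
  ... | yes onto = subst (λ h → fromℕℚ h ℚ.- ℚ.1ℚ ℚ.≤ xPart E x p) (sym imageSize≡)
                         (partition-constraint (suc k) p onto)
    where
    imageSize≡ : imageSize p ≡ suc k
    imageSize≡ = trans
      (Σℕ.sum-cong-≗ (λ j → cong (if_then 1 else 0) (inImage-true p (proj₁ (onto j)) (proj₂ (onto j)))))
      (∑ℕ-const-1 (suc k))
  ... | no ¬onto = subst₂ (λ h X → fromℕℚ h ℚ.- ℚ.1ℚ ℚ.≤ X) (sym imageSize-relabel) xPart≡
                          (partition-constraint-on-image relabel)
    where
    unused : ∃ λ j → ¬ (∃ λ u → p u ≡ j)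
    unused = FinP.¬∀⟶∃¬ (suc k) _ (λ j → FinP.any? (λ u → p u Fin.≟ j)) ¬onto
    open DropUnusedLabel p (proj₁ unused) (λ u j≡pu → proj₂ unused (u , sym j≡pu))

    xPart≡ : xPart E x relabel ≡ xPart E x p
    xPart≡ = trans (xPart-∑ E x relabel) (trans
      (Σℚ.sum-cong-≗ (λ e → cong (if_then ℚ.0ℚ else x e)
                                 (same-class (proj₁ (lookup E e)) (proj₂ (lookup E e)))))
      (sym (xPart-∑ E x p)))

-- Graphs attached at a vertex

-- G consists of H, embedded by emb, together with further edges that meet H at most in the
-- attachment vertex emb zero; ret retracts G onto H, collapsing everything outside H onto it.
record Attached {n} (G : Edges n) {c} (H : Edges (suc c)) : Set₁ where
  field
    emb            : Fin (suc c) → Fin n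
    ret            : Fin n → Fin (suc c)
    ret∘emb        : ∀ x → ret (emb x) ≡ x
    ret≡suc        : ∀ {u x} → ret u ≡ suc x → u ≡ emb (suc x)
    others         : ℕ
    edge           : EIdx H → EIdx G
    other          : Fin others → EIdx G
    lookup-edge    : ∀ i → lookup G (edge i) ≡ both emb (lookup H i)
    lookup-other   : ∀ j → both ret (lookup G (other j)) ≡ (zero , zero)
    edge-or-other  : ∀ e → (∃ λ i → edge i ≡ e) ⊎ (∃ λ j → other j ≡ e)
    edge-injective : ∀ {i i′} → edge i ≡ edge i′ → i ≡ i′
    edge≢other     : ∀ i j → edge i ≢ other j
    sum-split      : (M : CommutativeMonoid 0ℓ 0ℓ) → let open CommutativeMonoid M in
                     ∀ (f : EIdx G → Carrier) →
                     Sum.sum M f ≈ Sum.sum M (f ∘ edge) ∙ Sum.sum M (f ∘ other)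

module AttachedProperties {n} {G : Edges n} {c} {H : Edges (suc c)} (A : Attached G H) where
  open Attached A

  emb-injective : ∀ {x y} → emb x ≡ emb y → x ≡ y
  emb-injective {x} {y} eq = trans (sym (ret∘emb x)) (trans (cong ret eq) (ret∘emb y))

  both-ret∘emb : ∀ ab → both ret (both emb ab) ≡ ab
  both-ret∘emb (a , b) = cong₂ _,_ (ret∘emb a) (ret∘emb b)

  edge-endpoints : ∀ i {u w} → lookup G (edge i) ≡ (u , w) → lookup H i ≡ (ret u , ret w)
  edge-endpoints i {u} {w} eq = begin
    lookup H i                        ≡⟨ sym (both-ret∘emb (lookup H i)) ⟩
    both ret (both emb (lookup H i))  ≡⟨ cong (both ret) (trans (sym (lookup-edge i)) eq) ⟩
    (ret u , ret w)                   ∎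
    where open ≡-Reasoning

  other-endpoints : ∀ j {u w} → lookup G (other j) ≡ (u , w) → ret u ≡ ret w
  other-endpoints j {u} {w} eq = trans (cong proj₁ ret≡) (sym (cong proj₂ ret≡))
    where
    ret≡ : (ret u , ret w) ≡ (zero , zero)
    ret≡ = trans (cong (both ret) (sym eq)) (lookup-other j)

  reach-restrict : ∀ {m u w} → Reach G m u w → Reach H (m ∘ edge) (ret u) (ret w)
  reach-restrict here = here
  reach-restrict {m} (step {u} {w} {z} e m≥1 e∈ r) with edge-or-other e
  ... | inj₁ (i , refl) =
    step i m≥1 (Data.Sum.map (edge-endpoints i) (edge-endpoints i) e∈) (reach-restrict r)
  ... | inj₂ (j , refl) =
    subst (λ t → Reach H (m ∘ edge) t (ret z)) (sym ret-u≡ret-w) (reach-restrict r)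
    where
    ret-u≡ret-w : ret u ≡ ret w
    ret-u≡ret-w = Data.Sum.[ other-endpoints j , sym ∘ other-endpoints j ] e∈

  connected-restrict : ∀ {m} → ConnectedSub G m → ConnectedSub H (m ∘ edge)
  connected-restrict {m} C x y =
    subst₂ (Reach H (m ∘ edge)) (ret∘emb x) (ret∘emb y) (reach-restrict (C (emb x) (emb y)))

  reach-lift : ∀ {m x y} → Reach H (m ∘ edge) x y → Reach G m (emb x) (emb y)
  reach-lift here = here
  reach-lift (step i m≥1 i∈ r) = step (edge i) m≥1 (Data.Sum.map lift lift i∈) (reach-lift r)
    where
    lift : ∀ {ab} → lookup H i ≡ ab → lookup G (edge i) ≡ both emb ab
    lift = trans (lookup-edge i) ∘ cong (both emb)

  module _ (M : CommutativeMonoid 0ℓ 0ℓ) where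
    open CommutativeMonoid M using (Carrier; _≈_; _∙_; ε; setoid; ∙-cong; identityʳ; reflexive)
      renaming (trans to ≈-trans)
    open Sum M using (sum; sum-cong-≗)
    open import Relation.Binary.Reasoning.Setoid setoid

    -- Edges outside H retract to (zero , zero), so the hypothesis makes them contribute ε.
    sum-pullback : ∀ (φ : Fin (suc c) × Fin (suc c) → Carrier → Carrier) (f : EIdx G → Carrier) →
      (∀ y → φ (zero , zero) y ≈ ε) →
      sum (λ e → φ (both ret (lookup G e)) (f e)) ≈ sum (λ i → φ (lookup H i) (f (edge i)))
    sum-pullback φ f φ₀≈ε = begin
      sum (λ e → φ (both ret (lookup G e)) (f e))
        ≈⟨ sum-split M _ ⟩
      sum (λ i → φ (both ret (lookup G (edge i))) (f (edge i))) ∙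
      sum (λ j → φ (both ret (lookup G (other j))) (f (other j)))
        ≈⟨ ∙-cong (reflexive (sum-cong-≗ on-edges)) (SumProperties.sum-zero M _ on-others) ⟩
      sum (λ i → φ (lookup H i) (f (edge i))) ∙ ε
        ≈⟨ identityʳ _ ⟩
      sum (λ i → φ (lookup H i) (f (edge i))) ∎
      where
      on-edges : ∀ i → φ (both ret (lookup G (edge i))) (f (edge i)) ≡ φ (lookup H i) (f (edge i))
      on-edges i = cong (λ ab → φ ab (f (edge i)))
        (trans (cong (both ret) (lookup-edge i)) (both-ret∘emb (lookup H i)))
      on-others : ∀ j → φ (both ret (lookup G (other j))) (f (other j)) ≈ ε
      on-others j = ≈-trans (reflexive (cong (λ ab → φ ab (f (other j))) (lookup-other j))) (φ₀≈ε _)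

  ≟-emb-suc : ∀ x a → ⌊ emb (suc x) Fin.≟ a ⌋ ≡ ⌊ suc x Fin.≟ ret a ⌋
  ≟-emb-suc x a = ⌊⌋-⇔
    (mk⇔ (λ eq → trans (sym (ret∘emb (suc x))) (cong ret eq)) (λ eq → sym (ret≡suc (sym eq))))
    (emb (suc x) Fin.≟ a) (suc x Fin.≟ ret a)

  deg-emb-suc : ∀ m x → deg G m (emb (suc x)) ≡ deg H (m ∘ edge) (suc x)
  deg-emb-suc m x = begin
    deg G m (emb (suc x))
      ≡⟨ deg-∑ G m (emb (suc x)) ⟩
    ∑ℕ (λ e → degTerm (emb (suc x)) (lookup G e) (m e))
      ≡⟨ Σℕ.sum-cong-≗ (λ e → pulled (lookup G e) (m e)) ⟩
    ∑ℕ (λ e → degTerm (suc x) (both ret (lookup G e)) (m e))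
      ≡⟨ sum-pullback ℕP.+-0-commutativeMonoid (degTerm (suc x)) m (λ _ → refl) ⟩
    ∑ℕ (λ i → degTerm (suc x) (lookup H i) (m (edge i)))
      ≡⟨ sym (deg-∑ H (m ∘ edge) (suc x)) ⟩
    deg H (m ∘ edge) (suc x) ∎
    where
    open ≡-Reasoning
    pulled : ∀ ab y → degTerm (emb (suc x)) ab y ≡ degTerm (suc x) (both ret ab) y
    pulled (a , b) y = cong (if_then y else 0) (cong₂ _∨_ (≟-emb-suc x a) (≟-emb-suc x b))

  extend : Subset (suc c) → Subset n
  extend W = tabulate (vlookup W ∘ ret)

  restrict : Subset n → Subset (suc c)
  restrict W = tabulate (vlookup W ∘ emb)

  restrict∘extend : ∀ W x → vlookup (restrict (extend W)) x ≡ vlookup W x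
  restrict∘extend W x = trans (VecP.lookup∘tabulate (vlookup (extend W) ∘ emb) x)
    (trans (VecP.lookup∘tabulate (vlookup W ∘ ret) (emb x)) (cong (vlookup W) (ret∘emb x)))

  xCut-extend : ∀ x W → xCut G x (extend W) ≡ xCut H (x ∘ edge) W
  xCut-extend x W = begin
    xCut G x (extend W)
      ≡⟨ xCut-∑ G x (extend W) ⟩
    ∑ℚ (λ e → cutTerm (extend W) (lookup G e) (x e))
      ≡⟨ Σℚ.sum-cong-≗ (λ e → pulled (lookup G e) (x e)) ⟩
    ∑ℚ (λ e → cutTerm W (both ret (lookup G e)) (x e))
      ≡⟨ sum-pullback ℚP.+-0-commutativeMonoid (cutTerm W) x
           (λ y → cong (if_then y else ℚ.0ℚ) (BoolP.xor-same (vlookup W zero))) ⟩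
    ∑ℚ (λ i → cutTerm W (lookup H i) (x (edge i)))
      ≡⟨ sym (xCut-∑ H (x ∘ edge) W) ⟩
    xCut H (x ∘ edge) W ∎
    where
    open ≡-Reasoning
    pulled : ∀ ab y → cutTerm (extend W) ab y ≡ cutTerm W (both ret ab) y
    pulled (a , b) y = cong (if_then y else ℚ.0ℚ)
      (cong₂ _xor_ (VecP.lookup∘tabulate (vlookup W ∘ ret) a) (VecP.lookup∘tabulate (vlookup W ∘ ret) b))

  xPart-extend : ∀ {k} x (p : Fin (suc c) → Fin k) → xPart G x (p ∘ ret) ≡ xPart H (x ∘ edge) p
  xPart-extend x p = begin
    xPart G x (p ∘ ret)
      ≡⟨ xPart-∑ G x (p ∘ ret) ⟩
    ∑ℚ (λ e → partTerm p (both ret (lookup G e)) (x e))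
      ≡⟨ sum-pullback ℚP.+-0-commutativeMonoid (partTerm p) x
           (λ y → cong (if_then ℚ.0ℚ else y) (⌊⌋-true (p zero Fin.≟ p zero) refl)) ⟩
    ∑ℚ (λ i → partTerm p (lookup H i) (x (edge i)))
      ≡⟨ sym (xPart-∑ H (x ∘ edge) p) ⟩
    xPart H (x ∘ edge) p ∎
    where open ≡-Reasoning

  cutTerms-edge : ∀ x W →
    ∑ℚ (λ i → cutTerm W (lookup G (edge i)) (x (edge i))) ≡ xCut H (x ∘ edge) (restrict W)
  cutTerms-edge x W = trans (Σℚ.sum-cong-≗ on-edge) (sym (xCut-∑ H (x ∘ edge) (restrict W)))
    where
    on-edge : ∀ i → cutTerm W (lookup G (edge i)) (x (edge i)) ≡ cutTerm (restrict W) (lookup H i) (x (edge i))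
    on-edge i rewrite lookup-edge i = cong (if_then x (edge i) else ℚ.0ℚ) (sym (cong₂ _xor_
      (VecP.lookup∘tabulate (vlookup W ∘ emb) (proj₁ (lookup H i)))
      (VecP.lookup∘tabulate (vlookup W ∘ emb) (proj₂ (lookup H i)))))

  partTerms-edge : ∀ {k} x (p : Fin n → Fin k) →
    ∑ℚ (λ i → partTerm p (lookup G (edge i)) (x (edge i))) ≡ xPart H (x ∘ edge) (p ∘ emb)
  partTerms-edge x p = trans (Σℚ.sum-cong-≗ on-edge) (sym (xPart-∑ H (x ∘ edge) (p ∘ emb)))
    where
    on-edge : ∀ i → partTerm p (lookup G (edge i)) (x (edge i)) ≡ partTerm (p ∘ emb) (lookup H i) (x (edge i))
    on-edge i rewrite lookup-edge i = refl

  decrement-edge : ∀ m i → decrement m (edge i) ∘ edge ≗ decrement (m ∘ edge) i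
  decrement-edge m i i′ = cong (if_then m (edge i′) ∸ 1 else m (edge i′))
    (⌊⌋-⇔ (mk⇔ edge-injective (cong edge)) (edge i Fin.≟ edge i′) (i Fin.≟ i′))

  decrement-other : ∀ m j → decrement m (other j) ∘ edge ≗ m ∘ edge
  decrement-other m j i = cong (if_then m (edge i) ∸ 1 else m (edge i))
    (⌊⌋-false (other j Fin.≟ edge i) (edge≢other i j ∘ sym))

  parity-restrict-∩ : ∀ W {T T′} → (∀ x → vlookup T′ (suc x) ≡ vlookup T (emb (suc x))) →
    parity ∣ restrict W ∩ T′ ∣ ≡ (ℙ[ vlookup W (emb zero) ] *ℙ ℙ[ vlookup T′ zero ])
                                 +ℙ ∑ℙ (λ x → ℙ[ vlookup W (emb (suc x)) ] *ℙ ℙ[ vlookup T (emb (suc x)) ])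
  parity-restrict-∩ W {T} {T′} T′≡T = trans (parity-∣∩∣ (restrict W) T′) (cong₂ _+ℙ_
    (cong (λ w → ℙ[ w ] *ℙ ℙ[ vlookup T′ zero ]) (VecP.lookup∘tabulate (vlookup W ∘ emb) zero))
    (Σℙ.sum-cong-≗ λ x → cong₂ (λ w t → ℙ[ w ] *ℙ ℙ[ t ])
      (VecP.lookup∘tabulate (vlookup W ∘ emb) (suc x)) (T′≡T x)))

  restrictᴹ : MultiSub G → MultiSub H
  restrictᴹ (m , m≤2) = m ∘ edge , m≤2 ∘ edge

  module _ (T : Subset n) (T′ : Subset (suc c))
           (T′≡T : ∀ x → vlookup T′ (suc x) ≡ vlookup T (emb (suc x))) where

    IsTJoin-restrict : Loopless H → ∣ T′ ∣ % 2 ≡ 0 → ∀ {m} → IsTJoin G T m → IsTJoin H T′ (m ∘ edge)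
    IsTJoin-restrict loopless T′-even {m} J = IsTJoin-fromSuc {T = T′} loopless T′-even λ x → begin
      parity (deg H (m ∘ edge) (suc x)) ≡⟨ cong parity (sym (deg-emb-suc m x)) ⟩
      parity (deg G m (emb (suc x)))    ≡⟨ IsTJoin⇒parity {E = G} {T} {m} J (emb (suc x)) ⟩
      ℙ[ vlookup T (emb (suc x)) ]      ≡⟨ cong ℙ[_] (sym (T′≡T x)) ⟩
      ℙ[ vlookup T′ (suc x) ]           ∎
      where open ≡-Reasoning

    IsTJoin-emb-suc : ∀ {m m′} → m ∘ edge ≗ m′ → IsTJoin H T′ m′ →
      ∀ x → parity (deg G m (emb (suc x))) ≡ ℙ[ vlookup T (emb (suc x)) ]
    IsTJoin-emb-suc {m} {m′} m≗m′ J x = begin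
      parity (deg G m (emb (suc x)))    ≡⟨ cong parity (trans (deg-emb-suc m x) (deg-cong H m≗m′ (suc x))) ⟩
      parity (deg H m′ (suc x))         ≡⟨ IsTJoin⇒parity {E = H} {T′} {m′} J (suc x) ⟩
      ℙ[ vlookup T′ (suc x) ]           ≡⟨ cong ℙ[_] (T′≡T x) ⟩
      ℙ[ vlookup T (emb (suc x)) ]      ∎
      where open ≡-Reasoning

  Is2EC-restrict : ∀ F → Is2EC G F → Is2EC H (restrictᴹ F)
  Is2EC-restrict (m , _) (C , C-e) = connected-restrict C ,
    λ i m≥1 → connected-cong (decrement-edge m i) (connected-restrict (C-e (edge i) m≥1))

  LPFeasible-restrict : ∀ T T′ {x} → (∀ W → ∣ W ∩ T′ ∣ % 2 ≡ 0 → ∣ extend W ∩ T ∣ % 2 ≡ 0) →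
    LPFeasible G T x → LPFeasible H T′ (x ∘ edge)
  LPFeasible-restrict T T′ {x} even-extends (x≥0 , cut-constraint , partition-constraint) =
    x≥0 ∘ edge ,
    (λ W (u , u∈W) (u′ , u′∉W) W∩T′-even → subst (fromℕℚ 2 ℚ.≤_) (xCut-extend x W)
      (cut-constraint (extend W) (emb u , extend-emb W u u∈W) (emb u′ , extend-emb W u′ u′∉W)
                      (even-extends W W∩T′-even))) ,
    (λ k p onto → subst (fromℕℚ k ℚ.- ℚ.1ℚ ℚ.≤_) (xPart-extend x p)
      (partition-constraint k (p ∘ ret) λ j →
        let (u , pu≡j) = onto j in emb u , trans (cong p (ret∘emb u)) pu≡j))
    where
    extend-emb : ∀ W u {b} → vlookup W u ≡ b → vlookup (extend W) (emb u) ≡ b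
    extend-emb W u W-u≡b =
      trans (VecP.lookup∘tabulate (vlookup W ∘ ret) (emb u)) (trans (cong (vlookup W) (ret∘emb u)) W-u≡b)

module Append {A B C : Set} (f : A → C) (g : B → C) where

  _⊕_ : List A → List B → List C
  xs ⊕ ys = List.map f xs List.++ List.map g ys

  left : ∀ xs ys → Fin (length xs) → Fin (length (xs ⊕ ys))
  left (x ∷ xs) ys zero    = zero
  left (x ∷ xs) ys (suc i) = suc (left xs ys i)

  right : ∀ xs ys → Fin (length ys) → Fin (length (xs ⊕ ys))
  right []       (y ∷ ys) zero    = zero
  right []       (y ∷ ys) (suc j) = suc (right [] ys j)
  right (x ∷ xs) ys       j       = suc (right xs ys j)

  lookup-left : ∀ xs ys i → lookup (xs ⊕ ys) (left xs ys i) ≡ f (lookup xs i)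
  lookup-left (x ∷ xs) ys zero    = refl
  lookup-left (x ∷ xs) ys (suc i) = lookup-left xs ys i

  lookup-right : ∀ xs ys j → lookup (xs ⊕ ys) (right xs ys j) ≡ g (lookup ys j)
  lookup-right []       (y ∷ ys) zero    = refl
  lookup-right []       (y ∷ ys) (suc j) = lookup-right [] ys j
  lookup-right (x ∷ xs) ys       j       = lookup-right xs ys j

  left-or-right : ∀ xs ys e → (∃ λ i → left xs ys i ≡ e) ⊎ (∃ λ j → right xs ys j ≡ e)
  left-or-right []       (y ∷ ys) zero    = inj₂ (zero , refl)
  left-or-right []       (y ∷ ys) (suc e) with left-or-right [] ys e
  ... | inj₂ (j , refl) = inj₂ (suc j , refl)
  left-or-right (x ∷ xs) ys       zero    = inj₁ (zero , refl)
  left-or-right (x ∷ xs) ys       (suc e) with left-or-right xs ys e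
  ... | inj₁ (i , refl) = inj₁ (suc i , refl)
  ... | inj₂ (j , refl) = inj₂ (j , refl)

  copair : ∀ {D : Set} xs ys → (Fin (length xs) → D) → (Fin (length ys) → D) → Fin (length (xs ⊕ ys)) → D
  copair []       (y ∷ ys) h₁ h₂ zero    = h₂ zero
  copair []       (y ∷ ys) h₁ h₂ (suc e) = copair [] ys h₁ (h₂ ∘ suc) e
  copair (x ∷ xs) ys       h₁ h₂ zero    = h₁ zero
  copair (x ∷ xs) ys       h₁ h₂ (suc e) = copair xs ys (h₁ ∘ suc) h₂ e

  copair-left : ∀ {D : Set} xs ys (h₁ : Fin (length xs) → D) h₂ → copair xs ys h₁ h₂ ∘ left xs ys ≗ h₁
  copair-left (x ∷ xs) ys h₁ h₂ zero    = refl
  copair-left (x ∷ xs) ys h₁ h₂ (suc i) = copair-left xs ys (h₁ ∘ suc) h₂ i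

  copair-right : ∀ {D : Set} xs ys (h₁ : Fin (length xs) → D) h₂ → copair xs ys h₁ h₂ ∘ right xs ys ≗ h₂
  copair-right []       (y ∷ ys) h₁ h₂ zero    = refl
  copair-right []       (y ∷ ys) h₁ h₂ (suc j) = copair-right [] ys h₁ (h₂ ∘ suc) j
  copair-right (x ∷ xs) ys       h₁ h₂ j       = copair-right xs ys (h₁ ∘ suc) h₂ j

  left-injective : ∀ xs ys {i i′} → left xs ys i ≡ left xs ys i′ → i ≡ i′
  left-injective xs ys {i} {i′} eq = trans (sym (copair-left xs ys (λ k → k) (λ _ → i) i))
    (trans (cong (copair xs ys (λ k → k) (λ _ → i)) eq) (copair-left xs ys (λ k → k) (λ _ → i) i′))

  right-injective : ∀ xs ys {j j′} → right xs ys j ≡ right xs ys j′ → j ≡ j′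
  right-injective xs ys {j} {j′} eq = trans (sym (copair-right xs ys (λ _ → j) (λ k → k) j))
    (trans (cong (copair xs ys (λ _ → j) (λ k → k)) eq) (copair-right xs ys (λ _ → j) (λ k → k) j′))

  left≢right : ∀ xs ys i j → left xs ys i ≢ right xs ys j
  left≢right xs ys i j eq with trans (sym (copair-left xs ys (λ _ → true) (λ _ → false) i))
    (trans (cong (copair xs ys (λ _ → true) (λ _ → false)) eq) (copair-right xs ys (λ _ → true) (λ _ → false) j))
  ... | ()

  module _ (M : CommutativeMonoid 0ℓ 0ℓ) where
    open CommutativeMonoid M using (Carrier; _≈_; _∙_; ε; setoid; identityˡ; assoc; ∙-congˡ)
      renaming (sym to ≈-sym; trans to ≈-trans; reflexive to ≈-reflexive)
    open Sum M using (sum)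
    open import Relation.Binary.Reasoning.Setoid setoid

    sum-right-[] : ∀ ys (h : Fin (length ([] ⊕ ys)) → Carrier) → sum h ≡ sum (h ∘ right [] ys)
    sum-right-[] []       h = refl
    sum-right-[] (y ∷ ys) h = cong (h zero ∙_) (sum-right-[] ys (h ∘ suc))

    sum-⊕ : ∀ xs ys (h : Fin (length (xs ⊕ ys)) → Carrier) →
      sum h ≈ sum (h ∘ left xs ys) ∙ sum (h ∘ right xs ys)
    sum-⊕ []       ys h = ≈-sym (≈-trans (identityˡ _) (≈-reflexive (sym (sum-right-[] ys h))))
    sum-⊕ (x ∷ xs) ys h = begin
      h zero ∙ sum (h ∘ suc)                                              ≈⟨ ∙-congˡ (sum-⊕ xs ys (h ∘ suc)) ⟩
      h zero ∙ (sum (h ∘ suc ∘ left xs ys) ∙ sum (h ∘ suc ∘ right xs ys))  ≈⟨ ≈-sym (assoc _ _ _) ⟩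
      (h zero ∙ sum (h ∘ suc ∘ left xs ys)) ∙ sum (h ∘ suc ∘ right xs ys)  ∎

-- The one-vertex sum

evenChoice-suc : ∀ {c} N (f : Fin (suc c) → Fin N) T i →
  vlookup (evenChoice N f T) (suc i) ≡ vlookup T (f (suc i))
evenChoice-suc {c} N f T i =
  trans (lookup-if-∷ (∣ S ∣ % 2 ℕ.≡ᵇ 0) S) (VecP.lookup∘tabulate (vlookup T ∘ f ∘ suc) i)
  where
  S : Subset c
  S = tabulate (vlookup T ∘ f ∘ suc)
  lookup-if-∷ : ∀ b S → vlookup (if b then false Vec.∷ S else true Vec.∷ S) (suc i) ≡ vlookup S i
  lookup-if-∷ true  S = refl
  lookup-if-∷ false S = refl

evenChoice-even : ∀ {c} N (f : Fin (suc c) → Fin N) T → ∣ evenChoice N f T ∣ % 2 ≡ 0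
evenChoice-even {c} N f T = trans (cong (_% 2) (BoolP.if-float ∣_∣ (∣ S ∣ % 2 ℕ.≡ᵇ 0))) (even-choice ∣ S ∣)
  where
  S : Subset c
  S = tabulate (vlookup T ∘ f ∘ suc)
  even-choice : ∀ t → (if t % 2 ℕ.≡ᵇ 0 then t else suc t) % 2 ≡ 0
  even-choice t rewrite %2≡bit∘parity t with parity t in eq
  ... | 0ℙ = trans (%2≡bit∘parity t) (cong bit eq)
  ... | 1ℙ = trans (%2≡bit∘parity (suc t)) (cong bit (trans (ℙP.+-homo-+ 1 t) (cong (1ℙ +ℙ_) eq)))

module Vertices (a b : ℕ) where

  embed₁ : Fin (suc a) → Fin (suc (a + b))
  embed₁ = emb₁

  embed₂ : Fin (suc b) → Fin (suc (a + b))
  embed₂ = emb₂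

  ret₁ : Fin (suc (a + b)) → Fin (suc a)
  ret₁ zero    = zero
  ret₁ (suc k) = Data.Sum.[ suc , (λ _ → zero) ] (splitAt a k)

  ret₂ : Fin (suc (a + b)) → Fin (suc b)
  ret₂ zero    = zero
  ret₂ (suc k) = Data.Sum.[ (λ _ → zero) , suc ] (splitAt a k)

  ret₁∘embed₁ : ∀ x → ret₁ (embed₁ x) ≡ x
  ret₁∘embed₁ zero    = refl
  ret₁∘embed₁ (suc i) rewrite FinP.splitAt-↑ˡ a i b = refl

  ret₂∘embed₂ : ∀ y → ret₂ (embed₂ y) ≡ y
  ret₂∘embed₂ zero    = refl
  ret₂∘embed₂ (suc j) rewrite FinP.splitAt-↑ʳ a b j = refl

  ret₁∘embed₂ : ∀ y → ret₁ (embed₂ y) ≡ zero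
  ret₁∘embed₂ zero    = refl
  ret₁∘embed₂ (suc j) rewrite FinP.splitAt-↑ʳ a b j = refl

  ret₂∘embed₁ : ∀ x → ret₂ (embed₁ x) ≡ zero
  ret₂∘embed₁ zero    = refl
  ret₂∘embed₁ (suc i) rewrite FinP.splitAt-↑ˡ a i b = refl

  both-ret₁∘embed₂ : ∀ ab → both ret₁ (both embed₂ ab) ≡ (zero , zero)
  both-ret₁∘embed₂ (x , y) = cong₂ _,_ (ret₁∘embed₂ x) (ret₁∘embed₂ y)

  both-ret₂∘embed₁ : ∀ ab → both ret₂ (both embed₁ ab) ≡ (zero , zero)
  both-ret₂∘embed₁ (x , y) = cong₂ _,_ (ret₂∘embed₁ x) (ret₂∘embed₁ y)

  data View : Fin (suc (a + b)) → Set where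
    root  : View zero
    side₁ : ∀ i → View (embed₁ (suc i))
    side₂ : ∀ j → View (embed₂ (suc j))

  view : ∀ u → View u
  view zero = root
  view (suc k) with splitAt a k | FinP.join-splitAt a b k
  ... | inj₁ i | refl = side₁ i
  ... | inj₂ j | refl = side₂ j

  embed₁-or-embed₂ : ∀ u → (∃ λ x → embed₁ x ≡ u) ⊎ (∃ λ y → embed₂ y ≡ u)
  embed₁-or-embed₂ u with view u
  ... | root    = inj₁ (zero , refl)
  ... | side₁ i = inj₁ (suc i , refl)
  ... | side₂ j = inj₂ (suc j , refl)

  ret₁≡suc : ∀ {u x} → ret₁ u ≡ suc x → u ≡ embed₁ (suc x)
  ret₁≡suc {u} eq with view u
  ... | root    = contradiction eq λ ()
  ... | side₁ i = cong (embed₁ ∘ suc) (FinP.suc-injective (trans (sym (ret₁∘embed₁ (suc i))) eq))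
  ... | side₂ j = contradiction (trans (sym (ret₁∘embed₂ (suc j))) eq) λ ()

  ret₂≡suc : ∀ {u y} → ret₂ u ≡ suc y → u ≡ embed₂ (suc y)
  ret₂≡suc {u} eq with view u
  ... | root    = contradiction eq λ ()
  ... | side₁ i = contradiction (trans (sym (ret₂∘embed₁ (suc i))) eq) λ ()
  ... | side₂ j = cong (embed₂ ∘ suc) (FinP.suc-injective (trans (sym (ret₂∘embed₂ (suc j))) eq))

  ∑ℙ-vertices : ∀ (F : Fin (suc (a + b)) → Parity) →
    ∑ℙ F ≡ F zero +ℙ (∑ℙ (F ∘ embed₁ ∘ suc) +ℙ ∑ℙ (F ∘ embed₂ ∘ suc))
  ∑ℙ-vertices F = cong (F zero +ℙ_) (Σℙ.sum-↑ a b (F ∘ suc))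


module Glued {a b : ℕ} (E₁ : Edges (suc a)) (E₂ : Edges (suc b)) where
  open Vertices a b
  open Append (both embed₁) (both embed₂)

  G : Edges (suc (a + b))
  G = glue E₁ E₂

  edge₁ : EIdx E₁ → EIdx G
  edge₁ = left E₁ E₂

  edge₂ : EIdx E₂ → EIdx G
  edge₂ = right E₁ E₂

  attached₁ : Attached G E₁
  attached₁ = record
    { emb            = embed₁
    ; ret            = ret₁
    ; ret∘emb        = ret₁∘embed₁
    ; ret≡suc        = ret₁≡suc
    ; others         = length E₂
    ; edge           = edge₁
    ; other          = edge₂
    ; lookup-edge    = lookup-left E₁ E₂
    ; lookup-other   = λ j → trans (cong (both ret₁) (lookup-right E₁ E₂ j)) (both-ret₁∘embed₂ (lookup E₂ j))
    ; edge-or-other  = left-or-right E₁ E₂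
    ; edge-injective = left-injective E₁ E₂
    ; edge≢other     = left≢right E₁ E₂
    ; sum-split      = λ M → sum-⊕ M E₁ E₂
    }

  attached₂ : Attached G E₂
  attached₂ = record
    { emb            = embed₂
    ; ret            = ret₂
    ; ret∘emb        = ret₂∘embed₂
    ; ret≡suc        = ret₂≡suc
    ; others         = length E₁
    ; edge           = edge₂
    ; other          = edge₁
    ; lookup-edge    = lookup-right E₁ E₂
    ; lookup-other   = λ i → trans (cong (both ret₂) (lookup-left E₁ E₂ i)) (both-ret₂∘embed₁ (lookup E₁ i))
    ; edge-or-other  = Data.Sum.swap ∘ left-or-right E₁ E₂
    ; edge-injective = right-injective E₁ E₂
    ; edge≢other     = λ j i eq → left≢right E₁ E₂ i j (sym eq)
    ; sum-split      = λ M f → CommutativeMonoid.trans M (sum-⊕ M E₁ E₂ f) (CommutativeMonoid.comm M _ _)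
    }

  module A₁ = AttachedProperties attached₁
  module A₂ = AttachedProperties attached₂

  loopless : Loopless E₁ → Loopless E₂ → Loopless G
  loopless loopless₁ loopless₂ =
    AllP.++⁺ (AllP.map⁺ (All.map (λ a≢b → a≢b ∘ A₁.emb-injective) loopless₁))
             (AllP.map⁺ (All.map (λ a≢b → a≢b ∘ A₂.emb-injective) loopless₂))

  size-split : ∀ m → size G m ≡ size E₁ (m ∘ edge₁) + size E₂ (m ∘ edge₂)
  size-split m = trans (size-∑ G m) (trans (sum-⊕ ℕP.+-0-commutativeMonoid E₁ E₂ m)
    (sym (cong₂ _+_ (size-∑ E₁ (m ∘ edge₁)) (size-∑ E₂ (m ∘ edge₂)))))

  sumℚ-split : ∀ x → sumℚ x ≡ sumℚ (x ∘ edge₁) +ℚ sumℚ (x ∘ edge₂)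
  sumℚ-split x = trans (sumℚ≡∑ℚ x) (trans (sum-⊕ ℚP.+-0-commutativeMonoid E₁ E₂ x)
    (sym (cong₂ _+ℚ_ (sumℚ≡∑ℚ (x ∘ edge₁)) (sumℚ≡∑ℚ (x ∘ edge₂)))))

  xCut-split : ∀ x W →
    xCut G x W ≡ xCut E₁ (x ∘ edge₁) (A₁.restrict W) +ℚ xCut E₂ (x ∘ edge₂) (A₂.restrict W)
  xCut-split x W = trans (xCut-∑ G x W) (trans (sum-⊕ ℚP.+-0-commutativeMonoid E₁ E₂ _)
    (cong₂ _+ℚ_ (A₁.cutTerms-edge x W) (A₂.cutTerms-edge x W)))

  xPart-split : ∀ {k} x (p : Fin (suc (a + b)) → Fin k) →
    xPart G x p ≡ xPart E₁ (x ∘ edge₁) (p ∘ embed₁) +ℚ xPart E₂ (x ∘ edge₂) (p ∘ embed₂)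
  xPart-split x p = trans (xPart-∑ G x p) (trans (sum-⊕ ℚP.+-0-commutativeMonoid E₁ E₂ _)
    (cong₂ _+ℚ_ (A₁.partTerms-edge x p) (A₂.partTerms-edge x p)))

  connected-glue : ∀ {m} → ConnectedSub E₁ (m ∘ edge₁) → ConnectedSub E₂ (m ∘ edge₂) → ConnectedSub G m
  connected-glue {m} C₁ C₂ u w = reach-++ (to-root u) (from-root w)
    where
    to-root : ∀ u → Reach G m u zero
    to-root u with embed₁-or-embed₂ u
    ... | inj₁ (x , refl) = A₁.reach-lift (C₁ x zero)
    ... | inj₂ (y , refl) = A₂.reach-lift (C₂ y zero)
    from-root : ∀ w → Reach G m zero w
    from-root w with embed₁-or-embed₂ w
    ... | inj₁ (x , refl) = A₁.reach-lift (C₁ zero x)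
    ... | inj₂ (y , refl) = A₂.reach-lift (C₂ zero y)

  connected-copair : ∀ m {m₁ m₂} → m ∘ edge₁ ≗ m₁ → m ∘ edge₂ ≗ m₂ →
    ConnectedSub E₁ m₁ → ConnectedSub E₂ m₂ → ConnectedSub G m
  connected-copair m m₁≗ m₂≗ C₁ C₂ =
    connected-glue (connected-cong (sym ∘ m₁≗) C₁) (connected-cong (sym ∘ m₂≗) C₂)

  copairᴹ : MultiSub E₁ → MultiSub E₂ → MultiSub G
  copairᴹ (m₁ , m₁≤2) (m₂ , m₂≤2) = copair E₁ E₂ m₁ m₂ , bounded
    where
    bounded : ∀ e → copair E₁ E₂ m₁ m₂ e ≤ 2
    bounded e with left-or-right E₁ E₂ e
    ... | inj₁ (i , refl) = subst (_≤ 2) (sym (copair-left E₁ E₂ m₁ m₂ i)) (m₁≤2 i)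
    ... | inj₂ (j , refl) = subst (_≤ 2) (sym (copair-right E₁ E₂ m₁ m₂ j)) (m₂≤2 j)

  size-copair : ∀ m₁ m₂ → size G (copair E₁ E₂ m₁ m₂) ≡ size E₁ m₁ + size E₂ m₂
  size-copair m₁ m₂ = trans (size-split (copair E₁ E₂ m₁ m₂))
    (cong₂ _+_ (size-cong E₁ (copair-left E₁ E₂ m₁ m₂)) (size-cong E₂ (copair-right E₁ E₂ m₁ m₂)))

  2EC-glue : ∀ F₁ F₂ → Is2EC E₁ F₁ → Is2EC E₂ F₂ →
    Σ (MultiSub G) λ F → Is2EC G F × size G (proj₁ F) ≡ size E₁ (proj₁ F₁) + size E₂ (proj₁ F₂)
  2EC-glue F₁@(m₁ , _) F₂@(m₂ , _) (C₁ , C₁-e) (C₂ , C₂-e) =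
    copairᴹ F₁ F₂ , (connected-copair m m₁≗ m₂≗ C₁ C₂ , deletion) , size-copair m₁ m₂
    where
    m : EIdx G → ℕ
    m = copair E₁ E₂ m₁ m₂
    m₁≗ : m ∘ edge₁ ≗ m₁
    m₁≗ = copair-left E₁ E₂ m₁ m₂
    m₂≗ : m ∘ edge₂ ≗ m₂
    m₂≗ = copair-right E₁ E₂ m₁ m₂

    deletion : ∀ e → 1 ≤ m e → ConnectedSub G (decrement m e)
    deletion e m≥1 with left-or-right E₁ E₂ e
    ... | inj₁ (i , refl) = connected-copair (decrement m (edge₁ i))
      (λ i′ → trans (A₁.decrement-edge m i i′) (decrement-cong m₁≗ i i′))
      (λ j → trans (A₂.decrement-other m i j) (m₂≗ j))
      (C₁-e i (subst (1 ≤_) (m₁≗ i) m≥1)) C₂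
    ... | inj₂ (j , refl) = connected-copair (decrement m (edge₂ j))
      (λ i → trans (A₁.decrement-other m j i) (m₁≗ i))
      (λ j′ → trans (A₂.decrement-edge m j j′) (decrement-cong m₂≗ j j′))
      C₁ (C₂-e j (subst (1 ≤_) (m₂≗ j) m≥1))

  2EC-split : ∀ F → Is2EC G F →
    Σ (MultiSub E₁) λ F₁ → Σ (MultiSub E₂) λ F₂ →
      Is2EC E₁ F₁ × Is2EC E₂ F₂ × size G (proj₁ F) ≡ size E₁ (proj₁ F₁) + size E₂ (proj₁ F₂)
  2EC-split F 2ec =
    A₁.restrictᴹ F , A₂.restrictᴹ F ,
    A₁.Is2EC-restrict F 2ec , A₂.Is2EC-restrict F 2ec , size-split (proj₁ F)

  restrict₂∘extend₁ : ∀ W y → vlookup (A₂.restrict (A₁.extend W)) y ≡ vlookup W zero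
  restrict₂∘extend₁ W y = trans (VecP.lookup∘tabulate (vlookup (A₁.extend W) ∘ embed₂) y)
    (trans (VecP.lookup∘tabulate (vlookup W ∘ ret₁) (embed₂ y)) (cong (vlookup W) (ret₁∘embed₂ y)))

  restrict₁∘extend₂ : ∀ W x → vlookup (A₁.restrict (A₂.extend W)) x ≡ vlookup W zero
  restrict₁∘extend₂ W x = trans (VecP.lookup∘tabulate (vlookup (A₂.extend W) ∘ embed₁) x)
    (trans (VecP.lookup∘tabulate (vlookup W ∘ ret₂) (embed₁ x)) (cong (vlookup W) (ret₂∘embed₁ x)))

  -- Every label of p is used on one side, and the label of the shared vertex on both.
  imageSize-glue : ∀ {k} (p : Fin (suc (a + b)) → Fin k) → (∀ j → ∃ λ u → p u ≡ j) →
    k + 1 ≤ imageSize (p ∘ embed₁) + imageSize (p ∘ embed₂)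
  imageSize-glue {k} p onto = begin
    k + 1
      ≡⟨ sym (cong₂ _+_ (∑ℕ-const-1 k) (∑ℕ-indicator (p zero) 1)) ⟩
    ∑ℕ {k} (λ _ → 1) + ∑ℕ (λ j → δ j)
      ≡⟨ sym (Σℕ.∑-distrib-+ {k} (λ _ → 1) δ) ⟩
    ∑ℕ (λ j → 1 + δ j)
      ≤⟨ ∑ℕ-mono-≤ covered ⟩
    ∑ℕ (λ j → used₁ j + used₂ j)
      ≡⟨ Σℕ.∑-distrib-+ used₁ used₂ ⟩
    imageSize (p ∘ embed₁) + imageSize (p ∘ embed₂) ∎
    where
    open ℕP.≤-Reasoning
    δ used₁ used₂ : Fin k → ℕ
    δ j = if ⌊ j Fin.≟ p zero ⌋ then 1 else 0
    used₁ j = if inImage (p ∘ embed₁) j then 1 else 0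
    used₂ j = if inImage (p ∘ embed₂) j then 1 else 0

    covered : ∀ j → 1 + δ j ≤ used₁ j + used₂ j
    covered j with j Fin.≟ p zero
    ... | yes refl rewrite inImage-true (p ∘ embed₁) zero refl | inImage-true (p ∘ embed₂) zero refl = ℕP.≤-refl
    ... | no _ with onto j
    ...   | u , refl with embed₁-or-embed₂ u
    ...     | inj₁ (x , refl) rewrite inImage-true (p ∘ embed₁) x refl = s≤s z≤n
    ...     | inj₂ (y , refl) rewrite inImage-true (p ∘ embed₂) y refl = ℕP.m≤n+m 1 _

  module Terminals (T : Subset (suc (a + b))) (T-even : ∣ T ∣ % 2 ≡ 0) where

    T₁T : Subset (suc a)
    T₁T = T₁ {a} {b} T

    T₂T : Subset (suc b)
    T₂T = T₂ {a} {b} T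

    T₁T-suc : ∀ x → vlookup T₁T (suc x) ≡ vlookup T (embed₁ (suc x))
    T₁T-suc = evenChoice-suc (suc (a + b)) embed₁ T

    T₂T-suc : ∀ y → vlookup T₂T (suc y) ≡ vlookup T (embed₂ (suc y))
    T₂T-suc = evenChoice-suc (suc (a + b)) embed₂ T

    T₁T-even : ∣ T₁T ∣ % 2 ≡ 0
    T₁T-even = evenChoice-even (suc (a + b)) embed₁ T

    T₂T-even : ∣ T₂T ∣ % 2 ≡ 0
    T₂T-even = evenChoice-even (suc (a + b)) embed₂ T

    root-split : ℙ[ vlookup T zero ] ≡ ℙ[ vlookup T₁T zero ] +ℙ ℙ[ vlookup T₂T zero ]
    root-split = begin
      ℙ[ vlookup T zero ]
        ≡⟨ root-parity T T-even ⟩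
      ∑ℙ (λ k → ℙ[ vlookup T (suc k) ])
        ≡⟨ Σℙ.sum-↑ a b (λ k → ℙ[ vlookup T (suc k) ]) ⟩
      ∑ℙ (λ x → ℙ[ vlookup T (embed₁ (suc x)) ]) +ℙ ∑ℙ (λ y → ℙ[ vlookup T (embed₂ (suc y)) ])
        ≡⟨ sym (cong₂ _+ℙ_ (side T₁T embed₁ T₁T-even T₁T-suc) (side T₂T embed₂ T₂T-even T₂T-suc)) ⟩
      ℙ[ vlookup T₁T zero ] +ℙ ℙ[ vlookup T₂T zero ] ∎
      where
      open ≡-Reasoning
      side : ∀ {c} (S : Subset (suc c)) (emb : Fin (suc c) → Fin (suc (a + b))) → ∣ S ∣ % 2 ≡ 0 →
        (∀ x → vlookup S (suc x) ≡ vlookup T (emb (suc x))) →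
        ℙ[ vlookup S zero ] ≡ ∑ℙ (λ x → ℙ[ vlookup T (emb (suc x)) ])
      side S emb S-even S≡T = trans (root-parity S S-even) (Σℙ.sum-cong-≗ (cong ℙ[_] ∘ S≡T))

    parity-∩-split : ∀ W →
      parity ∣ W ∩ T ∣ ≡ parity ∣ A₁.restrict W ∩ T₁T ∣ +ℙ parity ∣ A₂.restrict W ∩ T₂T ∣
    parity-∩-split W = begin
      parity ∣ W ∩ T ∣
        ≡⟨ parity-∣∩∣ W T ⟩
      ∑ℙ (λ u → w u *ℙ t u)
        ≡⟨ ∑ℙ-vertices (λ u → w u *ℙ t u) ⟩
      (w zero *ℙ t zero) +ℙ (I₁ +ℙ I₂)
        ≡⟨ cong (λ τ → (w zero *ℙ τ) +ℙ (I₁ +ℙ I₂)) root-split ⟩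
      (w zero *ℙ (s₁ +ℙ s₂)) +ℙ (I₁ +ℙ I₂)
        ≡⟨ cong (_+ℙ (I₁ +ℙ I₂)) (ℙP.*-distribˡ-+ (w zero) s₁ s₂) ⟩
      ((w zero *ℙ s₁) +ℙ (w zero *ℙ s₂)) +ℙ (I₁ +ℙ I₂)
        ≡⟨ CommutativeSemigroupProperties.interchange ℙP.+-commutativeSemigroup
             (w zero *ℙ s₁) (w zero *ℙ s₂) I₁ I₂ ⟩
      ((w zero *ℙ s₁) +ℙ I₁) +ℙ ((w zero *ℙ s₂) +ℙ I₂)
        ≡⟨ sym (cong₂ _+ℙ_ (A₁.parity-restrict-∩ W {T} {T₁T} T₁T-suc)
                           (A₂.parity-restrict-∩ W {T} {T₂T} T₂T-suc)) ⟩
      parity ∣ A₁.restrict W ∩ T₁T ∣ +ℙ parity ∣ A₂.restrict W ∩ T₂T ∣ ∎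
      where
      open ≡-Reasoning
      w t : Fin (suc (a + b)) → Parity
      w u = ℙ[ vlookup W u ]
      t u = ℙ[ vlookup T u ]
      s₁ s₂ I₁ I₂ : Parity
      s₁ = ℙ[ vlookup T₁T zero ]
      s₂ = ℙ[ vlookup T₂T zero ]
      I₁ = ∑ℙ (λ x → w (embed₁ (suc x)) *ℙ t (embed₁ (suc x)))
      I₂ = ∑ℙ (λ y → w (embed₂ (suc y)) *ℙ t (embed₂ (suc y)))

    extend₁-even : ∀ W → ∣ W ∩ T₁T ∣ % 2 ≡ 0 → ∣ A₁.extend W ∩ T ∣ % 2 ≡ 0
    extend₁-even W W-even = parity≡0ℙ⇒even ∣ A₁.extend W ∩ T ∣ (trans (parity-∩-split (A₁.extend W))
      (cong₂ _+ℙ_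
        (trans (parity-∣∩∣-cong (A₁.restrict (A₁.extend W)) W T₁T (A₁.restrict∘extend W))
               (even⇒parity≡0ℙ ∣ W ∩ T₁T ∣ W-even))
        (parity-∣∩∣-const (A₂.restrict (A₁.extend W)) T₂T (restrict₂∘extend₁ W) T₂T-even)))

    extend₂-even : ∀ W → ∣ W ∩ T₂T ∣ % 2 ≡ 0 → ∣ A₂.extend W ∩ T ∣ % 2 ≡ 0
    extend₂-even W W-even = parity≡0ℙ⇒even ∣ A₂.extend W ∩ T ∣ (trans (parity-∩-split (A₂.extend W))
      (cong₂ _+ℙ_
        (parity-∣∩∣-const (A₁.restrict (A₂.extend W)) T₁T (restrict₁∘extend₂ W) T₁T-even)
        (trans (parity-∣∩∣-cong (A₂.restrict (A₂.extend W)) W T₂T (A₂.restrict∘extend W))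
               (even⇒parity≡0ℙ ∣ W ∩ T₂T ∣ W-even))))

    module _ (loopless₁ : Loopless E₁) (loopless₂ : Loopless E₂) where

      connTJoin-glue : ∀ F₁ F₂ → IsConnTJoin E₁ T₁T F₁ → IsConnTJoin E₂ T₂T F₂ →
        Σ (MultiSub G) λ F → IsConnTJoin G T F × size G (proj₁ F) ≡ size E₁ (proj₁ F₁) + size E₂ (proj₁ F₂)
      connTJoin-glue F₁@(m₁ , _) F₂@(m₂ , _) (J₁ , C₁) (J₂ , C₂) =
        copairᴹ F₁ F₂ ,
        (IsTJoin-fromSuc {T = T} (loopless loopless₁ loopless₂) T-even at-suc ,
         connected-copair m m₁≗ m₂≗ C₁ C₂) ,
        size-copair m₁ m₂
        where
        m : EIdx G → ℕ
        m = copair E₁ E₂ m₁ m₂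
        m₁≗ : m ∘ edge₁ ≗ m₁
        m₁≗ = copair-left E₁ E₂ m₁ m₂
        m₂≗ : m ∘ edge₂ ≗ m₂
        m₂≗ = copair-right E₁ E₂ m₁ m₂
        at-suc : ∀ k → parity (deg G m (suc k)) ≡ ℙ[ vlookup T (suc k) ]
        at-suc k with view (suc k)
        ... | side₁ i = A₁.IsTJoin-emb-suc T T₁T T₁T-suc m₁≗ J₁ i
        ... | side₂ j = A₂.IsTJoin-emb-suc T T₂T T₂T-suc m₂≗ J₂ j

      connTJoin-split : ∀ F → IsConnTJoin G T F →
        Σ (MultiSub E₁) λ F₁ → Σ (MultiSub E₂) λ F₂ →
          IsConnTJoin E₁ T₁T F₁ × IsConnTJoin E₂ T₂T F₂ ×
          size G (proj₁ F) ≡ size E₁ (proj₁ F₁) + size E₂ (proj₁ F₂)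
      connTJoin-split F (J , C) =
        A₁.restrictᴹ F , A₂.restrictᴹ F ,
        (A₁.IsTJoin-restrict T T₁T T₁T-suc loopless₁ T₁T-even J , A₁.connected-restrict C) ,
        (A₂.IsTJoin-restrict T T₂T T₂T-suc loopless₂ T₂T-even J , A₂.connected-restrict C) ,
        size-split (proj₁ F)

    LP-split : ∀ x → LPFeasible G T x →
      Σ (EIdx E₁ → ℚ) λ x₁ → Σ (EIdx E₂ → ℚ) λ x₂ →
        LPFeasible E₁ T₁T x₁ × LPFeasible E₂ T₂T x₂ × sumℚ x ≡ sumℚ x₁ +ℚ sumℚ x₂
    LP-split x feasible =
      x ∘ edge₁ , x ∘ edge₂ ,
      A₁.LPFeasible-restrict T T₁T extend₁-even feasible ,
      A₂.LPFeasible-restrict T T₂T extend₂-even feasible ,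
      sumℚ-split x

    module _ x₁ x₂ (feasible₁ : LPFeasible E₁ T₁T x₁) (feasible₂ : LPFeasible E₂ T₂T x₂) where
      private
        x : EIdx G → ℚ
        x = copair E₁ E₂ x₁ x₂

        x₁≗ : x ∘ edge₁ ≗ x₁
        x₁≗ = copair-left E₁ E₂ x₁ x₂

        x₂≗ : x ∘ edge₂ ≗ x₂
        x₂≗ = copair-right E₁ E₂ x₁ x₂

        cut₁ cut₂ : Subset (suc (a + b)) → ℚ
        cut₁ W = xCut E₁ x₁ (A₁.restrict W)
        cut₂ W = xCut E₂ x₂ (A₂.restrict W)

        nonneg : ∀ e → ℚ.0ℚ ℚ.≤ x e
        nonneg e with left-or-right E₁ E₂ e
        ... | inj₁ (i , refl) = subst (ℚ.0ℚ ℚ.≤_) (sym (x₁≗ i)) (proj₁ feasible₁ i)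
        ... | inj₂ (j , refl) = subst (ℚ.0ℚ ℚ.≤_) (sym (x₂≗ j)) (proj₁ feasible₂ j)

        sides-agree : ∀ W → ∣ W ∩ T ∣ % 2 ≡ 0 →
          parity ∣ A₁.restrict W ∩ T₁T ∣ ≡ parity ∣ A₂.restrict W ∩ T₂T ∣
        sides-agree W W-even = +ℙ≡0ℙ⇒≡ (trans (sym (parity-∩-split W)) (even⇒parity≡0ℙ ∣ W ∩ T ∣ W-even))

        not-both-constant : ∀ W →
          (∀ x → vlookup (A₁.restrict W) x ≡ vlookup (A₁.restrict W) zero) →
          (∀ y → vlookup (A₂.restrict W) y ≡ vlookup (A₂.restrict W) zero) → ¬ Proper W
        not-both-constant W const₁ const₂ ((u , W-u) , (u′ , W-u′)) =
          contradiction (trans (sym W-u) (trans (constant u) (trans (sym (constant u′)) W-u′))) λ ()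
          where
          side : ∀ {c} (emb : Fin (suc c) → Fin (suc (a + b))) → emb zero ≡ zero →
            (∀ x → vlookup (tabulate (vlookup W ∘ emb)) x ≡ vlookup (tabulate (vlookup W ∘ emb)) zero) →
            ∀ x → vlookup W (emb x) ≡ vlookup W zero
          side emb emb-zero const x = trans (sym (VecP.lookup∘tabulate (vlookup W ∘ emb) x))
            (trans (const x) (trans (VecP.lookup∘tabulate (vlookup W ∘ emb) zero) (cong (vlookup W) emb-zero)))
          constant : ∀ u → vlookup W u ≡ vlookup W zero
          constant u with embed₁-or-embed₂ u
          ... | inj₁ (x , refl) = side embed₁ refl const₁ x
          ... | inj₂ (y , refl) = side embed₂ refl const₂ y

        ≥2-by-side₁ : ∀ W → Proper (A₁.restrict W) → parity ∣ A₁.restrict W ∩ T₁T ∣ ≡ 0ℙ →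
          fromℕℚ 2 ℚ.≤ cut₁ W +ℚ cut₂ W
        ≥2-by-side₁ W (inside , outside) P≡0 = subst (ℚ._≤ cut₁ W +ℚ cut₂ W) (ℚP.+-identityʳ (fromℕℚ 2))
          (ℚP.+-mono-≤ (proj₁ (proj₂ feasible₁) (A₁.restrict W) inside outside
                                                (parity≡0ℙ⇒even ∣ A₁.restrict W ∩ T₁T ∣ P≡0))
                       (xCut-nonneg E₂ T₂T feasible₂ (A₂.restrict W)))

        ≥2-by-side₂ : ∀ W → Proper (A₂.restrict W) → parity ∣ A₂.restrict W ∩ T₂T ∣ ≡ 0ℙ →
          fromℕℚ 2 ℚ.≤ cut₁ W +ℚ cut₂ W
        ≥2-by-side₂ W (inside , outside) P≡0 = subst (ℚ._≤ cut₁ W +ℚ cut₂ W) (ℚP.+-identityˡ (fromℕℚ 2))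
          (ℚP.+-mono-≤ (xCut-nonneg E₁ T₁T feasible₁ (A₁.restrict W))
                       (proj₁ (proj₂ feasible₂) (A₂.restrict W) inside outside
                                                (parity≡0ℙ⇒even ∣ A₂.restrict W ∩ T₂T ∣ P≡0)))

        -- A proper trace of even parity is a constrained cut of its side, of weight ≥ 2; otherwise
        -- both traces are proper and odd, and each has weight ≥ 1.
        cut-bound : ∀ W → Proper W → ∣ W ∩ T ∣ % 2 ≡ 0 → fromℕℚ 2 ℚ.≤ cut₁ W +ℚ cut₂ W
        cut-bound W W-proper W-even with constant-or-proper (A₁.restrict W) | constant-or-proper (A₂.restrict W)
        ... | inj₁ const₁  | inj₁ const₂  = contradiction W-proper (not-both-constant W const₁ const₂)
        ... | inj₂ proper₁ | inj₁ const₂  = ≥2-by-side₁ W proper₁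
          (trans (sides-agree W W-even) (parity-∣∩∣-const (A₂.restrict W) T₂T const₂ T₂T-even))
        ... | inj₁ const₁  | inj₂ proper₂ = ≥2-by-side₂ W proper₂
          (trans (sym (sides-agree W W-even)) (parity-∣∩∣-const (A₁.restrict W) T₁T const₁ T₁T-even))
        ... | inj₂ proper₁ | inj₂ proper₂ with parity ∣ A₁.restrict W ∩ T₁T ∣ in P₁≡
        ...   | 0ℙ = ≥2-by-side₁ W proper₁ P₁≡
        ...   | 1ℙ = ℚP.+-mono-≤ (xCut-≥1 E₁ T₁T feasible₁ (A₁.restrict W) proper₁)
                                 (xCut-≥1 E₂ T₂T feasible₂ (A₂.restrict W) proper₂)

        cut-constraint : ∀ W → (∃ λ u → vlookup W u ≡ true) → (∃ λ u → vlookup W u ≡ false) →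
          ∣ W ∩ T ∣ % 2 ≡ 0 → fromℕℚ 2 ℚ.≤ xCut G x W
        cut-constraint W inside outside W-even = subst (fromℕℚ 2 ℚ.≤_)
          (sym (trans (xCut-split x W)
                      (cong₂ _+ℚ_ (xCut-cong E₁ x₁≗ (A₁.restrict W)) (xCut-cong E₂ x₂≗ (A₂.restrict W)))))
          (cut-bound W (inside , outside) W-even)

        partition-constraint : ∀ k (p : Fin (suc (a + b)) → Fin k) → (∀ j → ∃ λ u → p u ≡ j) →
          fromℕℚ k ℚ.- ℚ.1ℚ ℚ.≤ xPart G x p
        partition-constraint k p onto = begin
          fromℕℚ k ℚ.- ℚ.1ℚ
            ≤⟨ fromℕℚ-minus-one-≤ {k} {imageSize p₁} {imageSize p₂} (imageSize-glue p onto) ⟩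
          (fromℕℚ (imageSize p₁) ℚ.- ℚ.1ℚ) +ℚ (fromℕℚ (imageSize p₂) ℚ.- ℚ.1ℚ)
            ≤⟨ ℚP.+-mono-≤ (partition-constraint-on-image E₁ T₁T feasible₁ p₁)
                           (partition-constraint-on-image E₂ T₂T feasible₂ p₂) ⟩
          xPart E₁ x₁ p₁ +ℚ xPart E₂ x₂ p₂
            ≡⟨ sym (trans (xPart-split x p) (cong₂ _+ℚ_ (xPart-cong E₁ x₁≗ p₁) (xPart-cong E₂ x₂≗ p₂))) ⟩
          xPart G x p ∎
          where
          open ℚP.≤-Reasoning
          p₁ : Fin (suc a) → Fin k
          p₁ = p ∘ embed₁
          p₂ : Fin (suc b) → Fin k
          p₂ = p ∘ embed₂

      LP-glue : Σ (EIdx G → ℚ) λ x → LPFeasible G T x × sumℚ x ≡ sumℚ x₁ +ℚ sumℚ x₂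
      LP-glue = x , (nonneg , cut-constraint , partition-constraint) ,
        trans (sumℚ-split x) (cong₂ _+ℚ_ (sumℚ-cong x₁≗) (sumℚ-cong x₂≗))

proposition3 : (a b : ℕ) (E₁ : Edges (suc a)) (E₂ : Edges (suc b))
    → Loopless E₁ → Loopless E₂ → Connected E₁ → Connected E₂
    → (T : Subset (suc (a + b))) → ∣ T ∣ % 2 ≡ 0
    → ((k₁ k₂ : ℕ) → IsOPT E₁ (T₁ {a} {b} T) k₁ → IsOPT E₂ (T₂ {a} {b} T) k₂
         → IsOPT (glue E₁ E₂) T (k₁ + k₂))
    × ((k₁ k₂ : ℕ) → IsOPT2EC E₁ k₁ → IsOPT2EC E₂ k₂
         → IsOPT2EC (glue E₁ E₂) (k₁ + k₂))
    × ((q₁ q₂ : ℚ) → IsLP E₁ (T₁ {a} {b} T) q₁ → IsLP E₂ (T₂ {a} {b} T) q₂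
         → IsLP (glue E₁ E₂) T (q₁ +ℚ q₂))
proposition3 a b E₁ E₂ loopless₁ loopless₂ _ _ T T-even =
  (λ _ _ → minimum-+ {_≼_ = _≤_} {_+_} ℕP.+-mono-≤
             (connTJoin-glue loopless₁ loopless₂) (connTJoin-split loopless₁ loopless₂)) ,
  (λ _ _ → minimum-+ {_≼_ = _≤_} {_+_} ℕP.+-mono-≤ 2EC-glue 2EC-split) ,
  (λ _ _ → minimum-+ {_≼_ = ℚ._≤_} {_+ℚ_} ℚP.+-mono-≤ LP-glue LP-split)
  where
  open Glued E₁ E₂
  open Terminals T T-even
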